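{- Let $\mathsf L\in\{\mathsf N_\preccurlyeq,\mathsf{NN}_\preccurlyeq,\mathsf{NT}_\preccurlyeq,\mathsf{NW}_\preccurlyeq,\mathsf{NC}_\preccurlyeq,\mathsf{NA}_\preccurlyeq,\mathsf{NNA}_\preccurlyeq\}$ and let $\mathsf{H.L}$ be the corresponding hypersequent calculus. For every hypersequent $\mathcal H$, if $\mathcal H$ is valid in all $\mathsf L$-models, then $\mathcal H$ is derivable in $\mathsf{H.L}$.
   Context: Language: formulas $A ::= p \mid \bot \mid A\to A \mid A \preccurlyeq A$ over a countable set $Atm$ of atoms; $\top,\neg,\wedge,\vee$ defined as usual. A neighbourhood model is $\mathcal M=\langle W,N,V\rangle$ with $W\ne\emptyset$, $V:Atm\to\mathcal P(W)$, $N:W\to\mathcal P(\mathcal P(W))$ with $\emptyset\notin N(w)$. Forcing: $w\Vdash p$ iff $w\in V(p)$; $w\not\Vdash\bot$; $w\Vdash B\to C$ iff $w\Vdash B$ implies $w\Vdash C$; $w\Vdash B\preccurlyeq C$ iff for all $\alpha\in N(w)$, if some $v\in\alpha$ forces $C$ then some $u\in\alpha$ forces $B$. $\mathcal M\models A$ iff $A$ is forced at all worlds. Conditions (for all $w$): (N) $N(w)\ne\emptyset$; (T) some $\alpha\in N(w)$ contains $w$; (W) $N(w)\ne\emptyset$ and every $\alpha\in N(w)$ contains $w$; (C) $\{w\}\in N(w)$ and every $\alpha\in N(w)$ contains $w$; (A) if $\alpha\in N(w)$ and $v\in\alpha$ then $N(v)=N(w)$. $\mathsf L$-models: $\mathsf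 N_\preccurlyeq$: all; $\mathsf{NN}_\preccurlyeq$: (N); $\mathsf{NT}_\preccurlyeq$: (T); $\mathsf{NW}_\preccurlyeq$: (W); $\mathsf{NC}_\preccurlyeq$: (C); $\mathsf{NA}_\preccurlyeq$: (A); $\mathsf{NNA}_\preccurlyeq$: (N),(A). Hypersequents: a block $[\Sigma\lhd A]$: finite multiset $\Sigma$ of formulas and formula $A$; a sequent with blocks $\Gamma\Rightarrow\Delta$: $\Gamma$ finite multiset of formulas, $\Delta$ finite multiset of formulas and blocks, interpreted as the formula $\bigwedge\Gamma\to\bigvee\Delta'\vee(\bigvee\Sigma_1\preccurlyeq C_1)\vee\dots\vee(\bigvee\Sigma_k\preccurlyeq C_k)$ where $\Delta'$ are the formulas and $[\Sigma_i\lhd C_i]$ the blocks of $\Delta$; a hypersequent is a finite multiset $\Gamma_1\Rightarrow\Delta_1\mid\dots\mid\Gamma_n\Rightarrow\Delta_n$ of these (components); it is valid in $\mathcal M$ if some component's interpretation is valid in $\mathcal M$. Rules ($\mathcal G$ = other components): init: $\mathcal G\mid\Gamma,p\Rightarrow p,\Delta$; $\bot_L$: $\mathcal G\mid\Gamma,\bot\Rightarrow\Delta$; $\to_L$: from $\mathcal G\mid\Gamma,A\to B,B\Rightarrow\Delta$ and $\mathcal G\mid\Gamma,A\to B\Rightarrow\Delta,A$ infer $\mathcal G\mid\Gamma,A\to B\Rightarrow\Delta$; $\to_R$: from $\mathcal G\mid\Gamma,A\Rightarrow\Delta,A\to B,B$ infer $\mathcal G\mid\Gamma\Rightarrow\Delta,A\to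 B$; $\preccurlyeq_L$: from $\mathcal G\mid\Gamma,A\preccurlyeq B\Rightarrow\Delta,[B,\Sigma\lhd C]$ and $\mathcal G\mid\Gamma,A\preccurlyeq B\Rightarrow\Delta,[\Sigma\lhd C],[\Sigma\lhd A]$ infer $\mathcal G\mid\Gamma,A\preccurlyeq B\Rightarrow\Delta,[\Sigma\lhd C]$; $\preccurlyeq_R$: from $\mathcal G\mid\Gamma\Rightarrow\Delta,A\preccurlyeq B,[A\lhd B]$ infer $\mathcal G\mid\Gamma\Rightarrow\Delta,A\preccurlyeq B$; jp: from $\mathcal G\mid\Gamma\Rightarrow\Delta,[\Sigma\lhd A]\mid A\Rightarrow\Sigma$ infer $\mathcal G\mid\Gamma\Rightarrow\Delta,[\Sigma\lhd A]$; N: from $\mathcal G\mid\Gamma\Rightarrow\Delta,[\bot\lhd\top]$ infer $\mathcal G\mid\Gamma\Rightarrow\Delta$; T: from $\mathcal G\mid\Gamma,A\preccurlyeq B\Rightarrow\Delta,B$ and $\mathcal G\mid\Gamma,A\preccurlyeq B\Rightarrow\Delta,[\bot\lhd A]$ infer $\mathcal G\mid\Gamma,A\preccurlyeq B\Rightarrow\Delta$; W: from $\mathcal G\mid\Gamma\Rightarrow\Delta,[\Sigma\lhd A],\Sigma$ infer $\mathcal G\mid\Gamma\Rightarrow\Delta,[\Sigma\lhd A]$; C: from $\mathcal G\mid\Gamma,A\preccurlyeq B\Rightarrow\Delta,B$ and $\mathcal G\mid\Gamma,A\preccurlyeq B,A\Rightarrow\Delta$ infer $\mathcal G\mid\Gamma,A\preccurlyeq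 B\Rightarrow\Delta$; $\mathrm A_L$: from $\mathcal G\mid\Gamma,A\preccurlyeq B\Rightarrow\Delta\mid\Omega,A\preccurlyeq B\Rightarrow\Theta$ infer $\mathcal G\mid\Gamma,A\preccurlyeq B\Rightarrow\Delta\mid\Omega\Rightarrow\Theta$; $\mathrm A_R$: from $\mathcal G\mid\Gamma\Rightarrow\Delta,A\preccurlyeq B\mid\Omega\Rightarrow\Theta,A\preccurlyeq B$ infer $\mathcal G\mid\Gamma\Rightarrow\Delta,A\preccurlyeq B\mid\Omega\Rightarrow\Theta$. $\mathsf{H.N}=\{\mathrm{init},\bot_L,\to_L,\to_R,\preccurlyeq_L,\preccurlyeq_R,\mathrm{jp}\}$; $\mathsf{H.NN}=\mathsf{H.N}+$N; $\mathsf{H.NT}=\mathsf{H.N}+$T; $\mathsf{H.NW}=\mathsf{H.N}+$T,W; $\mathsf{H.NC}=\mathsf{H.N}+$W,C; $\mathsf{H.NA}=\mathsf{H.N}+\mathrm A_L,\mathrm A_R$; $\mathsf{H.NNA}=\mathsf{H.NN}+\mathrm A_L,\mathrm A_R$. The calculus for $\mathsf NX_\preccurlyeq$ is $\mathsf{H.N}X$. -}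

module Defs where

open import Data.Nat using (ℕ)
open import Data.List using (List; []; _∷_; foldr; map; _++_)
open import Data.List.Relation.Unary.Any using (Any)
open import Data.List.Relation.Binary.Permutation.Propositional using (_↭_)
open import Data.Product using (Σ; ∃; _×_; _,_)
open import Relation.Binary.PropositionalEquality using (_≡_)
open import Function.Bundles using (_⇔_)
open import Level using (Lift) renaming (suc to lsuc; zero to lzero)

infixr 6 _⇒_
infix 7 _≼_

data Fml : Set where
  atom : ℕ → Fml
  falsum : Fml
  _⇒_ : Fml → Fml → Fml
  _≼_ : Fml → Fml → Fml

¬f : Fml → Fml
¬f A = A ⇒ falsum

verum : Fml
verum = ¬f falsum

_∨f_ : Fml → Fml → Fml
A ∨f B = ¬f A ⇒ B

_∧f_ : Fml → Fml → Fml
A ∧f B = ¬f (A ⇒ ¬f B)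

⋀ : List Fml → Fml
⋀ = foldr _∧f_ verum

⋁ : List Fml → Fml
⋁ = foldr _∨f_ falsum

record Model : Set₁ where
  field
    W   : Set
    w₀  : W                                   -- W ≠ ∅
    N   : W → (W → Set) → Set
    V   : ℕ → W → Set
    -- N(w) is a set of subsets: invariant under extensional equality of subsets
    N-ext : ∀ w (α β : W → Set) → (∀ v → α v ⇔ β v) → N w α → N w β
    N-ne  : ∀ w (α : W → Set) → N w α → Σ W α

module _ (M : Model) where
  open Model M

  _⊩_ : W → Fml → Set₁
  w ⊩ atom p = Lift (lsuc lzero) (V p w)
  w ⊩ falsum = Lift (lsuc lzero) Data.Empty.⊥ where import Data.Empty
  w ⊩ (B ⇒ C) = w ⊩ B → w ⊩ C
  w ⊩ (B ≼ C) = ∀ (α : W → Set) → N w α →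
                  (Σ W λ v → α v × v ⊩ C) → Σ W λ u → α u × u ⊩ B

Valid : (M : Model) → Fml → Set₁
Valid M A = ∀ w → _⊩_ M w A

module _ (M : Model) where
  open Model M

  CondN : Set₁
  CondN = ∀ w → Σ (W → Set) λ α → N w α

  CondT : Set₁
  CondT = ∀ w → Σ (W → Set) λ α → N w α × α w

  CondW : Set₁
  CondW = ∀ w → (Σ (W → Set) λ α → N w α) × (∀ α → N w α → α w)

  CondC : Set₁
  CondC = ∀ w → N w (λ v → v ≡ w) × (∀ α → N w α → α w)

  CondA : Set₁
  CondA = ∀ w α v → N w α → α v → ∀ β → (N v β ⇔ N w β)

data Logic : Set where
  LN LNN LNT LNW LNC LNA LNNA : Logic

IsModel : Logic → Model → Set₁
IsModel LN   M = Lift (lsuc lzero) Data.Unit.⊤ where import Data.Unit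
IsModel LNN  M = CondN M
IsModel LNT  M = CondT M
IsModel LNW  M = CondW M
IsModel LNC  M = CondC M
IsModel LNA  M = CondA M
IsModel LNNA M = CondN M × CondA M

-- Hypersequents (multisets represented by lists, with exchange below)

data Item : Set where
  fml : Fml → Item
  blk : List Fml → Fml → Item

infix 4 _⇛_
record Comp : Set where
  constructor _⇛_
  field
    ant : List Fml
    suc : List Item

Hyp : Set
Hyp = List Comp

fmlsOf : List Item → List Fml
fmlsOf [] = []
fmlsOf (fml A ∷ Δ) = A ∷ fmlsOf Δ
fmlsOf (blk _ _ ∷ Δ) = fmlsOf Δ

blksOf : List Item → List Fml
blksOf [] = []
blksOf (fml _ ∷ Δ) = blksOf Δ
blksOf (blk Σ' C ∷ Δ) = (⋁ Σ' ≼ C) ∷ blksOf Δ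

interp : Comp → Fml
interp (Γ ⇛ Δ) = ⋀ Γ ⇒ (⋁ (fmlsOf Δ) ∨f ⋁ (blksOf Δ))

ValidHyp : Model → Hyp → Set₁
ValidHyp M H = Any (λ c → Valid M (interp c)) H

ValidL : Logic → Hyp → Set₁
ValidL L H = ∀ (M : Model) → IsModel L M → ValidHyp M H

data HasN : Logic → Set where
  nn : HasN LNN
  nna : HasN LNNA

data HasT : Logic → Set where
  nt : HasT LNT
  nw : HasT LNW

data HasW : Logic → Set where
  nw : HasW LNW
  nc : HasW LNC

data HasC : Logic → Set where
  nc : HasC LNC

data HasA : Logic → Set where
  na : HasA LNA
  nna : HasA LNNA

-- Derivability in H.L.  Principal formulas / components are displayed at
-- the front of the lists; the ex-* rules realise the multiset reading.

data ⊢[_]_ (L : Logic) : Hyp → Set where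
  ex-H : ∀ {G G'} → G ↭ G' → ⊢[ L ] G → ⊢[ L ] G'
  ex-Γ : ∀ {G Γ Γ' Δ} → Γ ↭ Γ' → ⊢[ L ] ((Γ ⇛ Δ) ∷ G) → ⊢[ L ] ((Γ' ⇛ Δ) ∷ G)
  ex-Δ : ∀ {G Γ Δ Δ'} → Δ ↭ Δ' → ⊢[ L ] ((Γ ⇛ Δ) ∷ G) → ⊢[ L ] ((Γ ⇛ Δ') ∷ G)
  ex-Σ : ∀ {G Γ Δ Σ' Σ'' A} → Σ' ↭ Σ'' →
         ⊢[ L ] ((Γ ⇛ (blk Σ' A ∷ Δ)) ∷ G) → ⊢[ L ] ((Γ ⇛ (blk Σ'' A ∷ Δ)) ∷ G)

  init : ∀ {G Γ Δ p} → ⊢[ L ] ((atom p ∷ Γ ⇛ fml (atom p) ∷ Δ) ∷ G)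
  ⊥L   : ∀ {G Γ Δ} → ⊢[ L ] ((falsum ∷ Γ ⇛ Δ) ∷ G)
  ⇒L   : ∀ {G Γ Δ A B} →
         ⊢[ L ] ((B ∷ (A ⇒ B) ∷ Γ ⇛ Δ) ∷ G) →
         ⊢[ L ] (((A ⇒ B) ∷ Γ ⇛ fml A ∷ Δ) ∷ G) →
         ⊢[ L ] (((A ⇒ B) ∷ Γ ⇛ Δ) ∷ G)
  ⇒R   : ∀ {G Γ Δ A B} →
         ⊢[ L ] ((A ∷ Γ ⇛ fml (A ⇒ B) ∷ fml B ∷ Δ) ∷ G) →
         ⊢[ L ] ((Γ ⇛ fml (A ⇒ B) ∷ Δ) ∷ G)
  ≼L   : ∀ {G Γ Δ A B Σ' C} →
         ⊢[ L ] (((A ≼ B) ∷ Γ ⇛ blk (B ∷ Σ') C ∷ Δ) ∷ G) →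
         ⊢[ L ] (((A ≼ B) ∷ Γ ⇛ blk Σ' C ∷ blk Σ' A ∷ Δ) ∷ G) →
         ⊢[ L ] (((A ≼ B) ∷ Γ ⇛ blk Σ' C ∷ Δ) ∷ G)
  ≼R   : ∀ {G Γ Δ A B} →
         ⊢[ L ] ((Γ ⇛ fml (A ≼ B) ∷ blk (A ∷ []) B ∷ Δ) ∷ G) →
         ⊢[ L ] ((Γ ⇛ fml (A ≼ B) ∷ Δ) ∷ G)
  jp   : ∀ {G Γ Δ Σ' A} →
         ⊢[ L ] ((Γ ⇛ blk Σ' A ∷ Δ) ∷ (A ∷ [] ⇛ map fml Σ') ∷ G) →
         ⊢[ L ] ((Γ ⇛ blk Σ' A ∷ Δ) ∷ G)

  ruleN : HasN L → ∀ {G Γ Δ} →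
         ⊢[ L ] ((Γ ⇛ blk (falsum ∷ []) verum ∷ Δ) ∷ G) →
         ⊢[ L ] ((Γ ⇛ Δ) ∷ G)
  ruleT : HasT L → ∀ {G Γ Δ A B} →
         ⊢[ L ] (((A ≼ B) ∷ Γ ⇛ fml B ∷ Δ) ∷ G) →
         ⊢[ L ] (((A ≼ B) ∷ Γ ⇛ blk (falsum ∷ []) A ∷ Δ) ∷ G) →
         ⊢[ L ] (((A ≼ B) ∷ Γ ⇛ Δ) ∷ G)
  ruleW : HasW L → ∀ {G Γ Δ Σ' A} →
         ⊢[ L ] ((Γ ⇛ blk Σ' A ∷ (map fml Σ' ++ Δ)) ∷ G) →
         ⊢[ L ] ((Γ ⇛ blk Σ' A ∷ Δ) ∷ G)
  ruleC : HasC L → ∀ {G Γ Δ A B} →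
         ⊢[ L ] (((A ≼ B) ∷ Γ ⇛ fml B ∷ Δ) ∷ G) →
         ⊢[ L ] ((A ∷ (A ≼ B) ∷ Γ ⇛ Δ) ∷ G) →
         ⊢[ L ] (((A ≼ B) ∷ Γ ⇛ Δ) ∷ G)
  ruleAL : HasA L → ∀ {G Γ Δ Ω Θ A B} →
         ⊢[ L ] (((A ≼ B) ∷ Γ ⇛ Δ) ∷ ((A ≼ B) ∷ Ω ⇛ Θ) ∷ G) →
         ⊢[ L ] (((A ≼ B) ∷ Γ ⇛ Δ) ∷ (Ω ⇛ Θ) ∷ G)
  ruleAR : HasA L → ∀ {G Γ Δ Ω Θ A B} →
         ⊢[ L ] ((Γ ⇛ fml (A ≼ B) ∷ Δ) ∷ (Ω ⇛ fml (A ≼ B) ∷ Θ) ∷ G) →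
         ⊢[ L ] ((Γ ⇛ fml (A ≼ B) ∷ Δ) ∷ (Ω ⇛ Θ) ∷ G)

module Submission where

-- Completeness by failed proof search.  Fix the finite set S of subformulas of H.  A
-- search state records which formulas of S, and which blocks over S, occur in a
-- component; applying the rules of H.L backwards terminates, and either derives every
-- component realising the state or reaches saturated extensions of it.  The saturated
-- consistent states become the worlds of a countermodel after repeatedly discarding
-- states with a block [σ ◁ C] that has no surviving witness (a state with C on the left
-- and σ on the right); the state space is finite, so this stabilises.  A block whose
-- witnesses were all discarded is handled by jp: its premise C ⇛ σ is searched in turn,
-- and in the logics with A the ≼-formulas of the component are first copied into it by
-- A_L/A_R; a saturated extension of the premise that disagrees on ≼-formulas lets the
-- state under consideration acquire new ≼-formulas, which happens only finitely often.
-- Neighbourhoods are generated by closed blocks, the truth lemma holds, and each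
-- component of H is refuted at a world extending its state.

open import Defs
open import Data.Nat using (ℕ; zero; suc; _≤_; _<_; z≤n; s≤s; _+_)
open import Data.Nat.Properties using (≤-refl; ≤-trans; <-≤-trans; m≤n⇒m≤1+n; +-mono-≤; +-mono-<-≤; +-mono-≤-<)
import Data.Nat.Properties as ℕ
open import Data.Bool using (Bool; true; false; T; _∨_; _∧_)
open import Data.Bool.Properties using (T-∨; T-∧; ∧-assoc; ∧-idem)
open import Data.Unit using (⊤; tt)
open import Data.Empty using (⊥; ⊥-elim)
open import Data.Product using (Σ; _×_; _,_; proj₁; proj₂)
open import Data.Sum using (_⊎_; inj₁; inj₂; map₁)
open import Data.Product.Properties using (≡-dec)
open import Data.List using (List; []; _∷_; map; _++_; concatMap; cartesianProduct)
open import Data.List.Relation.Unary.Any using (Any; here; there; any?)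
open import Data.List.Relation.Unary.All using (all?)
import Data.List.Relation.Unary.All as All
open import Data.List.Membership.Propositional using (_∈_; lose; find)
open import Data.List.Membership.Propositional.Properties using (∈-concatMap⁺; ∈-concatMap⁻; ∈-++⁺ˡ; ∈-++⁺ʳ; ∈-++⁻; ∈-map⁺; ∈-cartesianProduct⁻; ∈-cartesianProduct⁺)
open import Data.List.Relation.Binary.Permutation.Propositional using (_↭_; ↭-refl; ↭-prep; ↭-swap; ↭-trans; ↭-sym)
open import Data.List.Relation.Binary.Permutation.Propositional.Properties using (∈-resp-↭)
open import Relation.Binary.PropositionalEquality using (_≡_; _≢_; refl; sym; trans; cong; cong₂; subst)
open import Relation.Binary.Definitions using (DecidableEquality)
open import Relation.Nullary using (Dec; yes; no; ¬_)
open import Relation.Nullary.Decidable using (⌊_⌋; toWitness; map′; _×-dec_; _→-dec_; T?; ¬?; decidable-stable; _⊎-dec_)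
open import Function.Bundles using (_⇔_; mk⇔; Equivalence)
open import Level using (Lift; lift; lower)

_≟ᶠ_ : DecidableEquality Fml
atom n ≟ᶠ atom m = map′ (cong atom) (λ { refl → refl }) (n ℕ.≟ m)
atom n ≟ᶠ falsum = no λ ()
atom n ≟ᶠ (_ ⇒ _) = no λ ()
atom n ≟ᶠ (_ ≼ _) = no λ ()
falsum ≟ᶠ atom _ = no λ ()
falsum ≟ᶠ falsum = yes refl
falsum ≟ᶠ (_ ⇒ _) = no λ ()
falsum ≟ᶠ (_ ≼ _) = no λ ()
(_ ⇒ _) ≟ᶠ atom _ = no λ ()
(_ ⇒ _) ≟ᶠ falsum = no λ ()
(A ⇒ B) ≟ᶠ (C ⇒ D) = map′ (λ (p , q) → cong₂ _⇒_ p q) (λ { refl → refl , refl }) (A ≟ᶠ C ×-dec B ≟ᶠ D)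
(_ ⇒ _) ≟ᶠ (_ ≼ _) = no λ ()
(_ ≼ _) ≟ᶠ atom _ = no λ ()
(_ ≼ _) ≟ᶠ falsum = no λ ()
(_ ≼ _) ≟ᶠ (_ ⇒ _) = no λ ()
(A ≼ B) ≟ᶠ (C ≼ D) = map′ (λ (p , q) → cong₂ _≼_ p q) (λ { refl → refl , refl }) (A ≟ᶠ C ×-dec B ≟ᶠ D)

-- Subsets of a finite universe as bit vectors.  `gaps s`, the number of absent elements,
-- strictly decreases along strict inclusion; it is the termination measure throughout.
module FiniteSubset {X : Set} (_≟_ : DecidableEquality X) where

  open import Data.List.Membership.DecPropositional _≟_ using (_∈?_)

  Subset : List X → Set
  Subset [] = ⊤
  Subset (x ∷ U) = Bool × Subset U

  mem : ∀ {U} → X → Subset U → Set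
  mem {[]} a _ = ⊥
  mem {y ∷ U} a (b , s) = (T b × y ≡ a) ⊎ mem a s

  mem⇒∈ : ∀ {U} a (s : Subset U) → mem a s → a ∈ U
  mem⇒∈ {y ∷ U} a (b , s) (inj₁ (_ , refl)) = here refl
  mem⇒∈ {y ∷ U} a (b , s) (inj₂ m) = there (mem⇒∈ a s m)

  toList : ∀ {U} → Subset U → List X
  toList {[]} _ = []
  toList {y ∷ U} (true , s) = y ∷ toList s
  toList {y ∷ U} (false , s) = toList s

  ∈-toList⁺ : ∀ {U} a (s : Subset U) → mem a s → a ∈ toList s
  ∈-toList⁺ {y ∷ U} a (true , s) (inj₁ (_ , refl)) = here refl
  ∈-toList⁺ {y ∷ U} a (true , s) (inj₂ m) = there (∈-toList⁺ a s m)
  ∈-toList⁺ {y ∷ U} a (false , s) (inj₂ m) = ∈-toList⁺ a s m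

  ∈-toList⁻ : ∀ {U} a (s : Subset U) → a ∈ toList s → mem a s
  ∈-toList⁻ {y ∷ U} a (true , s) (here refl) = inj₁ (tt , refl)
  ∈-toList⁻ {y ∷ U} a (true , s) (there m) = inj₂ (∈-toList⁻ a s m)
  ∈-toList⁻ {y ∷ U} a (false , s) m = inj₂ (∈-toList⁻ a s m)

  mem? : ∀ {U} a (s : Subset U) → Dec (mem a s)
  mem? a s = map′ (∈-toList⁻ a s) (∈-toList⁺ a s) (a ∈? toList s)

  ∃-mem? : ∀ {U} {P : X → Set} → (∀ a → Dec (P a)) → (s : Subset U) → Dec (Σ X λ a → mem a s × P a)
  ∃-mem? P? s = map′ from to (any? P? (toList s))
    where
    from : Any _ (toList s) → Σ X λ a → mem a s × _
    from p = let a , a∈ , pa = find p in a , ∈-toList⁻ a s a∈ , pa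
    to : (Σ X λ a → mem a s × _) → Any _ (toList s)
    to (a , m , pa) = lose (∈-toList⁺ a s m) pa

  ∀-mem? : ∀ {U} {P : X → Set} → (∀ a → Dec (P a)) → (s : Subset U) → Dec (∀ a → mem a s → P a)
  ∀-mem? P? s = map′ (λ ps a m → All.lookup ps (∈-toList⁺ a s m)) (λ f → All.tabulate λ {a} a∈ → f a (∈-toList⁻ a s a∈))
    (all? P? (toList s))

  empty : ∀ {U} → Subset U
  empty {[]} = tt
  empty {y ∷ U} = false , empty

  ¬mem-empty : ∀ {U} a → ¬ mem {U} a empty
  ¬mem-empty {y ∷ U} a (inj₂ m) = ¬mem-empty a m

  insert : ∀ {U} → X → Subset U → Subset U
  insert {[]} a _ = tt
  insert {y ∷ U} a (b , s) = (b ∨ ⌊ y ≟ a ⌋) , insert a s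

  mem-insert-self : ∀ {U} a (s : Subset U) → a ∈ U → mem a (insert a s)
  mem-insert-self {y ∷ U} a (b , s) (here refl) with y ≟ y
  ... | yes _ = inj₁ (Equivalence.from (T-∨ {b}) (inj₂ tt) , refl)
  ... | no ne = ⊥-elim (ne refl)
  mem-insert-self {y ∷ U} a (b , s) (there p) = inj₂ (mem-insert-self a s p)

  mem-insert⁺ : ∀ {U} a c (s : Subset U) → mem c s → mem c (insert a s)
  mem-insert⁺ {y ∷ U} a c (b , s) (inj₁ (t , eq)) = inj₁ (Equivalence.from (T-∨ {b}) (inj₁ t) , eq)
  mem-insert⁺ {y ∷ U} a c (b , s) (inj₂ m) = inj₂ (mem-insert⁺ a c s m)

  mem-insert⁻ : ∀ {U} a c (s : Subset U) → mem c (insert a s) → mem c s ⊎ c ≡ a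
  mem-insert⁻ {y ∷ U} a c (b , s) (inj₁ (t , eq)) with Equivalence.to (T-∨ {b}) t
  ... | inj₁ tb = inj₁ (inj₁ (tb , eq))
  ... | inj₂ ty = inj₂ (trans (sym eq) (toWitness ty))
  mem-insert⁻ {y ∷ U} a c (b , s) (inj₂ m) with mem-insert⁻ a c s m
  ... | inj₁ m' = inj₁ (inj₂ m')
  ... | inj₂ e = inj₂ e

  fromList : ∀ {U} → List X → Subset U
  fromList [] = empty
  fromList (x ∷ xs) = insert x (fromList xs)

  mem-fromList⁻ : ∀ {U a} xs → mem {U} a (fromList xs) → a ∈ xs
  mem-fromList⁻ [] m = ⊥-elim (¬mem-empty _ m)
  mem-fromList⁻ (x ∷ xs) m with mem-insert⁻ x _ (fromList xs) m
  ... | inj₁ m' = there (mem-fromList⁻ xs m')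
  ... | inj₂ refl = here refl

  mem-fromList⁺ : ∀ {U a} xs → (∀ y → y ∈ xs → y ∈ U) → a ∈ xs → mem {U} a (fromList xs)
  mem-fromList⁺ (x ∷ xs) h (here refl) = mem-insert-self x (fromList xs) (h x (here refl))
  mem-fromList⁺ (x ∷ xs) h (there m) = mem-insert⁺ x _ (fromList xs) (mem-fromList⁺ xs (λ y p → h y (there p)) m)

  _∪_ : ∀ {U} → Subset U → Subset U → Subset U
  _∪_ {[]} _ _ = tt
  _∪_ {y ∷ U} (b , s) (c , t) = (b ∨ c) , (s ∪ t)

  mem-∪⁻ : ∀ {U} a (s t : Subset U) → mem a (s ∪ t) → mem a s ⊎ mem a t
  mem-∪⁻ {y ∷ U} a (b , s) (c , t) (inj₁ (x , eq)) with Equivalence.to (T-∨ {b}) x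
  ... | inj₁ tb = inj₁ (inj₁ (tb , eq))
  ... | inj₂ tc = inj₂ (inj₁ (tc , eq))
  mem-∪⁻ {y ∷ U} a (b , s) (c , t) (inj₂ m) with mem-∪⁻ a s t m
  ... | inj₁ m' = inj₁ (inj₂ m')
  ... | inj₂ m' = inj₂ (inj₂ m')

  _⊆_ : ∀ {U} → Subset U → Subset U → Set
  _⊆_ {[]} _ _ = ⊤
  _⊆_ {y ∷ U} (b , s) (c , t) = (T b → T c) × (s ⊆ t)

  _⊆?_ : ∀ {U} (s t : Subset U) → Dec (s ⊆ t)
  _⊆?_ {[]} s t = yes tt
  _⊆?_ {y ∷ U} (b , s) (c , t) = (T? b →-dec T? c) ×-dec (s ⊆? t)

  ⊆-refl : ∀ {U} (s : Subset U) → s ⊆ s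
  ⊆-refl {[]} _ = tt
  ⊆-refl {y ∷ U} (b , s) = (λ x → x) , ⊆-refl s

  ⊆-trans : ∀ {U} {s t u : Subset U} → s ⊆ t → t ⊆ u → s ⊆ u
  ⊆-trans {[]} _ _ = tt
  ⊆-trans {y ∷ U} (f , p) (g , q) = (λ x → g (f x)) , ⊆-trans p q

  ⊆-antisym : ∀ {U} {s t : Subset U} → s ⊆ t → t ⊆ s → s ≡ t
  ⊆-antisym {[]} {tt} {tt} _ _ = refl
  ⊆-antisym {y ∷ U} {b , s} {c , t} (f , p) (g , q) =
    cong₂ _,_ (T-ext b c f g) (⊆-antisym p q)
    where
    T-ext : ∀ b c → (T b → T c) → (T c → T b) → b ≡ c
    T-ext true true _ _ = refl
    T-ext false false _ _ = refl
    T-ext true false f _ = ⊥-elim (f tt)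
    T-ext false true _ g = ⊥-elim (g tt)

  mem-⊆ : ∀ {U} {s t : Subset U} a → s ⊆ t → mem a s → mem a t
  mem-⊆ {y ∷ U} a (f , p) (inj₁ (x , eq)) = inj₁ (f x , eq)
  mem-⊆ {y ∷ U} a (f , p) (inj₂ m) = inj₂ (mem-⊆ a p m)

  empty-⊆ : ∀ {U} (s : Subset U) → empty ⊆ s
  empty-⊆ {[]} _ = tt
  empty-⊆ {y ∷ U} (b , s) = (λ ()) , empty-⊆ s

  ⊆-insert : ∀ {U} a (s : Subset U) → s ⊆ insert a s
  ⊆-insert {[]} a s = tt
  ⊆-insert {y ∷ U} a (b , s) = (λ x → Equivalence.from (T-∨ {b}) (inj₁ x)) , ⊆-insert a s

  ⊆-∪ˡ : ∀ {U} (s t : Subset U) → s ⊆ (s ∪ t)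
  ⊆-∪ˡ {[]} _ _ = tt
  ⊆-∪ˡ {y ∷ U} (b , s) (c , t) = (λ x → Equivalence.from (T-∨ {b}) (inj₁ x)) , ⊆-∪ˡ s t

  ⊆-∪ʳ : ∀ {U} (s t : Subset U) → t ⊆ (s ∪ t)
  ⊆-∪ʳ {[]} _ _ = tt
  ⊆-∪ʳ {y ∷ U} (b , s) (c , t) = (λ x → Equivalence.from (T-∨ {b}) (inj₂ x)) , ⊆-∪ʳ s t

  _≟ˢ_ : ∀ {U} → DecidableEquality (Subset U)
  _≟ˢ_ {U} s t = map′ (λ (p , q) → ⊆-antisym p q) (λ { refl → ⊆-refl s , ⊆-refl s }) (s ⊆? t ×-dec t ⊆? s)

  allSubsets : ∀ U → List (Subset U)
  allSubsets [] = tt ∷ []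
  allSubsets (y ∷ U) = map (true ,_) (allSubsets U) ++ map (false ,_) (allSubsets U)

  ∈-allSubsets : ∀ {U} (s : Subset U) → s ∈ allSubsets U
  ∈-allSubsets {[]} tt = here refl
  ∈-allSubsets {y ∷ U} (true , s) = ∈-++⁺ˡ (∈-map⁺ (true ,_) (∈-allSubsets s))
  ∈-allSubsets {y ∷ U} (false , s) = ∈-++⁺ʳ (map (true ,_) (allSubsets U)) (∈-map⁺ (false ,_) (∈-allSubsets s))

  gaps : ∀ {U} → Subset U → ℕ
  gaps {[]} _ = 0
  gaps {y ∷ U} (true , s) = gaps s
  gaps {y ∷ U} (false , s) = suc (gaps s)

  gaps-anti : ∀ {U} {s t : Subset U} → s ⊆ t → gaps t ≤ gaps s
  gaps-anti {[]} _ = z≤n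
  gaps-anti {y ∷ U} {true , s} {true , t} (f , p) = gaps-anti p
  gaps-anti {y ∷ U} {true , s} {false , t} (f , p) = ⊥-elim (f tt)
  gaps-anti {y ∷ U} {false , s} {true , t} (f , p) = m≤n⇒m≤1+n (gaps-anti p)
  gaps-anti {y ∷ U} {false , s} {false , t} (f , p) = s≤s (gaps-anti p)

  gaps-<-≢ : ∀ {U} {s t : Subset U} → s ⊆ t → s ≢ t → gaps t < gaps s
  gaps-<-≢ {[]} {tt} {tt} _ ne = ⊥-elim (ne refl)
  gaps-<-≢ {y ∷ U} {true , s} {true , t} (h , p) ne = gaps-<-≢ p (λ e → ne (cong (true ,_) e))
  gaps-<-≢ {y ∷ U} {true , s} {false , t} (h , p) ne = ⊥-elim (h tt)
  gaps-<-≢ {y ∷ U} {false , s} {true , t} (h , p) ne = s≤s (gaps-anti p)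
  gaps-<-≢ {y ∷ U} {false , s} {false , t} (h , p) ne = s≤s (gaps-<-≢ p (λ e → ne (cong (false ,_) e)))

  gaps-< : ∀ {U} {s t : Subset U} a → s ⊆ t → mem a t → ¬ mem a s → gaps t < gaps s
  gaps-< a s⊆t m nm = gaps-<-≢ s⊆t λ { refl → nm m }

  restrict : ∀ {U} → (X → Bool) → Subset U → Subset U
  restrict {[]} f _ = tt
  restrict {y ∷ U} f (b , s) = (f y ∧ b) , restrict f s

  mem-restrict⁻ : ∀ {U} f a (s : Subset U) → mem a (restrict f s) → T (f a) × mem a s
  mem-restrict⁻ {y ∷ U} f a (b , s) (inj₁ (x , refl)) = let fa , tb = Equivalence.to (T-∧ {f y}) x in fa , inj₁ (tb , refl)
  mem-restrict⁻ {y ∷ U} f a (b , s) (inj₂ m) = let fa , m' = mem-restrict⁻ f a s m in fa , inj₂ m'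

  mem-restrict⁺ : ∀ {U} f a (s : Subset U) → T (f a) → mem a s → mem a (restrict f s)
  mem-restrict⁺ {y ∷ U} f a (b , s) fa (inj₁ (x , refl)) = inj₁ (Equivalence.from (T-∧ {f y}) (fa , x) , refl)
  mem-restrict⁺ {y ∷ U} f a (b , s) fa (inj₂ m) = inj₂ (mem-restrict⁺ f a s fa m)

  restrict-mono : ∀ {U} f {s t : Subset U} → s ⊆ t → restrict f s ⊆ restrict f t
  restrict-mono {[]} f _ = tt
  restrict-mono {y ∷ U} f {b , s} {c , t} (h , p) =
    (λ x → let fy , tb = Equivalence.to (T-∧ {f y}) x in Equivalence.from (T-∧ {f y}) (fy , h tb)) , restrict-mono f p

  restrict-idem : ∀ {U} f (s : Subset U) → restrict f (restrict f s) ≡ restrict f s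
  restrict-idem {[]} f s = refl
  restrict-idem {y ∷ U} f (b , s) = cong₂ _,_ (trans (sym (∧-assoc (f y) (f y) b)) (cong (_∧ b) (∧-idem (f y)))) (restrict-idem f s)

subformulas : Fml → List Fml
subformulas (atom p) = atom p ∷ []
subformulas falsum = falsum ∷ []
subformulas (A ⇒ B) = (A ⇒ B) ∷ subformulas A ++ subformulas B
subformulas (A ≼ B) = (A ≼ B) ∷ subformulas A ++ subformulas B

∈-subformulas-self : ∀ A → A ∈ subformulas A
∈-subformulas-self (atom p) = here refl
∈-subformulas-self falsum = here refl
∈-subformulas-self (A ⇒ B) = here refl
∈-subformulas-self (A ≼ B) = here refl

subformulas-trans : ∀ {A B} C → A ∈ subformulas B → B ∈ subformulas C → A ∈ subformulas C
subformulas-trans (atom p) a (here refl) = a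
subformulas-trans falsum a (here refl) = a
subformulas-trans (C ⇒ D) a (here refl) = a
subformulas-trans (C ⇒ D) a (there m) with ∈-++⁻ (subformulas C) m
... | inj₁ m' = there (∈-++⁺ˡ (subformulas-trans C a m'))
... | inj₂ m' = there (∈-++⁺ʳ (subformulas C) (subformulas-trans D a m'))
subformulas-trans (C ≼ D) a (here refl) = a
subformulas-trans (C ≼ D) a (there m) with ∈-++⁻ (subformulas C) m
... | inj₁ m' = there (∈-++⁺ˡ (subformulas-trans C a m'))
... | inj₂ m' = there (∈-++⁺ʳ (subformulas C) (subformulas-trans D a m'))

isPref : Fml → Bool
isPref (_ ≼ _) = true
isPref _ = false

IsPref : Fml → Set
IsPref x = T (isPref x)

IsAtom : Fml → Set
IsAtom x = Σ ℕ λ p → x ≡ atom p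

IsAtom? : ∀ x → Dec (IsAtom x)
IsAtom? (atom p) = yes (p , refl)
IsAtom? falsum = no λ { (_ , ()) }
IsAtom? (_ ⇒ _) = no λ { (_ , ()) }
IsAtom? (_ ≼ _) = no λ { (_ , ()) }

record SubformulaClosed (S : List Fml) : Set where
  field
    ⇒-closed : ∀ {A B} → (A ⇒ B) ∈ S → A ∈ S × B ∈ S
    ≼-closed : ∀ {A B} → (A ≼ B) ∈ S → A ∈ S × B ∈ S
    verum∈ : verum ∈ S

∈-concatMap-subformulas : ∀ {A B} xs → A ∈ subformulas B → B ∈ concatMap subformulas xs → A ∈ concatMap subformulas xs
∈-concatMap-subformulas xs a m =
  let B , B∈ , m' = find (∈-concatMap⁻ subformulas {xs = xs} m) in ∈-concatMap⁺ subformulas (lose B∈ (subformulas-trans B a m'))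

∈-concatMap-subformulas-self : ∀ {A} xs → A ∈ xs → A ∈ concatMap subformulas xs
∈-concatMap-subformulas-self {A} xs m = ∈-concatMap⁺ subformulas (lose m (∈-subformulas-self A))

concatMap-subformulas-closed : ∀ xs → verum ∈ xs → SubformulaClosed (concatMap subformulas xs)
concatMap-subformulas-closed xs verum∈xs = record
  { ⇒-closed = λ {A} {B} m → ∈-concatMap-subformulas xs (there (∈-++⁺ˡ (∈-subformulas-self A))) m
                            , ∈-concatMap-subformulas xs (there (∈-++⁺ʳ (subformulas A) (∈-subformulas-self B))) m
  ; ≼-closed = λ {A} {B} m → ∈-concatMap-subformulas xs (there (∈-++⁺ˡ (∈-subformulas-self A))) m
                            , ∈-concatMap-subformulas xs (there (∈-++⁺ʳ (subformulas A) (∈-subformulas-self B))) m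
  ; verum∈ = ∈-concatMap-subformulas-self xs verum∈xs
  }

itemFormulas : Item → List Fml
itemFormulas (fml A) = A ∷ []
itemFormulas (blk Σl C) = C ∷ Σl

compFormulas : Comp → List Fml
compFormulas (Γ ⇛ Δ) = Γ ++ concatMap itemFormulas Δ

∈-fmlsOf⁻ : ∀ {A Δ} → A ∈ fmlsOf Δ → fml A ∈ Δ
∈-fmlsOf⁻ {Δ = fml _ ∷ Δ} (here refl) = here refl
∈-fmlsOf⁻ {Δ = fml _ ∷ Δ} (there m) = there (∈-fmlsOf⁻ m)
∈-fmlsOf⁻ {Δ = blk _ _ ∷ Δ} m = there (∈-fmlsOf⁻ m)

∈-blksOf⁻ : ∀ {x Δ} → x ∈ blksOf Δ → Σ (List Fml) λ Σl → Σ Fml λ C → (x ≡ (⋁ Σl ≼ C)) × (blk Σl C ∈ Δ)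
∈-blksOf⁻ {Δ = fml _ ∷ Δ} m with ∈-blksOf⁻ m
... | Σl , C , e , bi = Σl , C , e , there bi
∈-blksOf⁻ {Δ = blk Σl C ∷ Δ} (here refl) = Σl , C , refl , here refl
∈-blksOf⁻ {Δ = blk _ _ ∷ Δ} (there m) with ∈-blksOf⁻ m
... | Σl , C , e , bi = Σl , C , e , there bi

∈⇒∷↭ : ∀ {A : Set} {x : A} {xs : List A} → x ∈ xs → Σ (List A) λ ys → (x ∷ ys) ↭ xs
∈⇒∷↭ {xs = y ∷ ys} (here refl) = ys , ↭-refl
∈⇒∷↭ {x = x} {xs = y ∷ ys} (there p) with ∈⇒∷↭ p
... | zs , q = (y ∷ zs) , ↭-trans (↭-swap x y ↭-refl) (↭-prep y q)

count : ∀ {A : Set} {P : A → Set} → (∀ x → Dec (P x)) → List A → ℕ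
count P? [] = 0
count P? (x ∷ xs) with P? x
... | yes _ = suc (count P? xs)
... | no _ = count P? xs

count-mono : ∀ {A : Set} {P Q : A → Set} (P? : ∀ x → Dec (P x)) (Q? : ∀ x → Dec (Q x)) →
             (∀ x → P x → Q x) → ∀ xs → count P? xs ≤ count Q? xs
count-mono P? Q? f [] = z≤n
count-mono P? Q? f (x ∷ xs) with P? x | Q? x
... | yes p | yes q = s≤s (count-mono P? Q? f xs)
... | yes p | no nq = ⊥-elim (nq (f x p))
... | no np | yes q = m≤n⇒m≤1+n (count-mono P? Q? f xs)
... | no np | no nq = count-mono P? Q? f xs

count-< : ∀ {A : Set} {P Q : A → Set} (P? : ∀ x → Dec (P x)) (Q? : ∀ x → Dec (Q x)) →
          (∀ x → P x → Q x) → ∀ {y} xs → y ∈ xs → Q y → ¬ P y → count P? xs < count Q? xs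
count-< P? Q? f (x ∷ xs) (here refl) q np with P? x | Q? x
... | yes p | _ = ⊥-elim (np p)
... | no _ | yes _ = s≤s (count-mono P? Q? f xs)
... | no _ | no nq = ⊥-elim (nq q)
count-< P? Q? f (x ∷ xs) (there m) q np with P? x | Q? x
... | yes p | yes _ = s≤s (count-< P? Q? f xs m q np)
... | yes p | no nq = ⊥-elim (nq (f x p))
... | no _ | yes _ = m≤n⇒m≤1+n (count-< P? Q? f xs m q np)
... | no _ | no _ = count-< P? Q? f xs m q np

Any⇒∷↭ : ∀ {A : Set} {P : A → Set} {xs} → Any P xs → Σ A λ x → Σ (List A) λ ys → P x × ((x ∷ ys) ↭ xs)
Any⇒∷↭ a with find a
... | x , m , p with ∈⇒∷↭ m
...   | ys , pr = x , ys , p , pr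

∈-resp-↭˘ : ∀ {A : Set} {xs ys : List A} → xs ↭ ys → ∀ z → z ∈ ys → z ∈ xs
∈-resp-↭˘ q z = ∈-resp-↭ (↭-sym q)

isN isT isW isC isA : Logic → Bool
isN LNN = true
isN LNNA = true
isN _ = false
isT LNT = true
isT LNW = true
isT _ = false
isW LNW = true
isW LNC = true
isW _ = false
isC LNC = true
isC _ = false
isA LNA = true
isA LNNA = true
isA _ = false

hasN : ∀ {L} → T (isN L) → HasN L
hasN {LNN} _ = nn
hasN {LNNA} _ = nna
hasT : ∀ {L} → T (isT L) → HasT L
hasT {LNT} _ = nt
hasT {LNW} _ = nw
hasW : ∀ {L} → T (isW L) → HasW L
hasW {LNW} _ = nw
hasW {LNC} _ = nc
hasC : ∀ {L} → T (isC L) → HasC L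
hasC {LNC} _ = nc
hasA : ∀ {L} → T (isA L) → HasA L
hasA {LNA} _ = na
hasA {LNNA} _ = nna

module Completeness (L : Logic) {S : List Fml} (closed : SubformulaClosed S) where

  open SubformulaClosed closed

  module SF = FiniteSubset _≟ᶠ_

  Block : Set
  Block = SF.Subset S × Fml

  _≟ᵇˡ_ : DecidableEquality Block
  _≟ᵇˡ_ = ≡-dec SF._≟ˢ_ _≟ᶠ_

  blockUniverse : List Block
  blockUniverse = cartesianProduct (SF.allSubsets S) S

  module SB = FiniteSubset _≟ᵇˡ_

  -- A state lists formulas known to be in the antecedent (g) and in the succedent (d) of a
  -- component, and blocks (σ , C) standing for some [Σ ◁ C] with σ ⊆ Σ; `ℓ ≽ t` says that
  -- component ℓ contains all of them.
  record State : Set where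
    constructor state
    field
      g d : SF.Subset S
      b : SB.Subset blockUniverse
  open State public

  _⊑_ : State → State → Set
  t ⊑ v = (g t SF.⊆ g v) × (d t SF.⊆ d v) × (b t SB.⊆ b v)

  ⊑-refl : ∀ t → t ⊑ t
  ⊑-refl t = SF.⊆-refl (g t) , SF.⊆-refl (d t) , SB.⊆-refl (b t)

  ⊑-trans : ∀ {t u v} → t ⊑ u → u ⊑ v → t ⊑ v
  ⊑-trans (a , b₁ , c) (a' , b' , c') = SF.⊆-trans a a' , SF.⊆-trans b₁ b' , SB.⊆-trans c c'

  _≽_ : Comp → State → Set
  ℓ ≽ t = (∀ A → SF.mem A (g t) → A ∈ Comp.ant ℓ)
        × (∀ A → SF.mem A (d t) → fml A ∈ Comp.suc ℓ)
        × (∀ σ C → SB.mem (σ , C) (b t) → Σ (List Fml) λ Σl → (blk Σl C ∈ Comp.suc ℓ) × (∀ A → SF.mem A σ → A ∈ Σl))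

  _⊆c_ : Comp → Comp → Set
  ℓ ⊆c ℓ' = (∀ A → A ∈ Comp.ant ℓ → A ∈ Comp.ant ℓ') × (∀ i → i ∈ Comp.suc ℓ → i ∈ Comp.suc ℓ')

  ≽-⊆c : ∀ {ℓ ℓ' t} → ℓ ≽ t → ℓ ⊆c ℓ' → ℓ' ≽ t
  ≽-⊆c (p , q , r) (u , v) = (λ A m → u A (p A m)) , (λ A m → v _ (q A m)) ,
    λ σ C m → let (Σl , i , h) = r σ C m in Σl , v _ i , h

  setG : State → SF.Subset S → State
  setG t x = state x (d t) (b t)
  setD : State → SF.Subset S → State
  setD t x = state (g t) x (b t)
  setB : State → SB.Subset blockUniverse → State
  setB t x = state (g t) (d t) x

  ≽-insertG : ∀ {ℓ t} X → ℓ ≽ t → X ∈ Comp.ant ℓ → ℓ ≽ setG t (SF.insert X (g t))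
  ≽-insertG {ℓ} {t} X (p , q , r) x = f , q , r
    where
    f : ∀ A → SF.mem A (SF.insert X (g t)) → A ∈ Comp.ant ℓ
    f A m with SF.mem-insert⁻ X A (g t) m
    ... | inj₁ m' = p A m'
    ... | inj₂ refl = x

  ≽-insertD : ∀ {ℓ t} X → ℓ ≽ t → fml X ∈ Comp.suc ℓ → ℓ ≽ setD t (SF.insert X (d t))
  ≽-insertD {ℓ} {t} X (p , q , r) x = p , f , r
    where
    f : ∀ A → SF.mem A (SF.insert X (d t)) → fml A ∈ Comp.suc ℓ
    f A m with SF.mem-insert⁻ X A (d t) m
    ... | inj₁ m' = q A m'
    ... | inj₂ refl = x

  ≽-∪D : ∀ {ℓ t} σ → ℓ ≽ t → (∀ A → SF.mem A σ → fml A ∈ Comp.suc ℓ) → ℓ ≽ setD t (d t SF.∪ σ)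
  ≽-∪D {ℓ} {t} σ (p , q , r) x = p , f , r
    where
    f : ∀ A → SF.mem A (d t SF.∪ σ) → fml A ∈ Comp.suc ℓ
    f A m with SF.mem-∪⁻ A (d t) σ m
    ... | inj₁ m' = q A m'
    ... | inj₂ m' = x A m'

  ≽-insertB : ∀ {ℓ t} σ C Σl → ℓ ≽ t → blk Σl C ∈ Comp.suc ℓ → (∀ A → SF.mem A σ → A ∈ Σl) → ℓ ≽ setB t (SB.insert (σ , C) (b t))
  ≽-insertB {ℓ} {t} σ C Σl (p , q , r) x h = p , q , f
    where
    f : ∀ τ D → SB.mem (τ , D) (SB.insert (σ , C) (b t)) → Σ (List Fml) λ Σl' → (blk Σl' D ∈ Comp.suc ℓ) × (∀ A → SF.mem A τ → A ∈ Σl')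
    f τ D m with SB.mem-insert⁻ (σ , C) (τ , D) (b t) m
    ... | inj₁ m' = r τ D m'
    ... | inj₂ refl = Σl , x , h

  single : Fml → SF.Subset S
  single A = SF.insert A SF.empty

  mem-single⁻ : ∀ {A a} → SF.mem a (single A) → a ≡ A
  mem-single⁻ {A} {a} m with SF.mem-insert⁻ A a SF.empty m
  ... | inj₁ e = ⊥-elim (SF.¬mem-empty a e)
  ... | inj₂ e = e

  mem⇒∈S : ∀ {a} (s : SF.Subset S) → SF.mem a s → a ∈ S
  mem⇒∈S s m = SF.mem⇒∈ _ s m

  block⇒∈S : ∀ {σ C} (s : SB.Subset blockUniverse) → SB.mem (σ , C) s → C ∈ S
  block⇒∈S {σ} {C} s m = proj₂ (∈-cartesianProduct⁻ (SF.allSubsets S) S (SB.mem⇒∈ _ s m))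

  ∈-blockUniverse : ∀ σ {C} → C ∈ S → (σ , C) ∈ blockUniverse
  ∈-blockUniverse σ c = ∈-cartesianProduct⁺ (SF.∈-allSubsets σ) c

  -- `Open…` says that applying a rule backwards to a principal formula would still add
  -- something to the state; a state is saturated when nothing is open.
  OpenImpL : State → Fml → Set
  OpenImpL t (A ⇒ B) = (¬ SF.mem B (g t)) × (¬ SF.mem A (d t))
  OpenImpL t _ = ⊥

  OpenImpR : State → Fml → Set
  OpenImpR t (A ⇒ B) = ¬ (SF.mem A (g t) × SF.mem B (d t))
  OpenImpR t _ = ⊥

  OpenPrefR : State → Fml → Set
  OpenPrefR t (A ≼ B) = ¬ SB.mem (single A , B) (b t)
  OpenPrefR t _ = ⊥

  OpenPrefLAt : State → Fml → Fml → Block → Set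
  OpenPrefLAt t A B (σ , C) = (¬ SF.mem B σ) × (¬ SB.mem (SF.insert B σ , C) (b t)) × (¬ SB.mem (σ , A) (b t))

  OpenPrefL : State → Fml → Set
  OpenPrefL t (A ≼ B) = Σ Block λ k → SB.mem k (b t) × OpenPrefLAt t A B k
  OpenPrefL t _ = ⊥

  OpenN : State → Set
  OpenN t = T (isN L) × (¬ SB.mem (single falsum , verum) (b t))

  OpenT : State → Fml → Set
  OpenT t (A ≼ B) = T (isT L) × (¬ SF.mem B (d t)) × (¬ SB.mem (single falsum , A) (b t))
  OpenT t _ = ⊥

  OpenWAt : State → Block → Set
  OpenWAt t (σ , C) = Σ Fml λ a → SF.mem a σ × (¬ SF.mem a (d t))

  OpenW : State → Set
  OpenW t = T (isW L) × (Σ Block λ k → SB.mem k (b t) × OpenWAt t k)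

  OpenC : State → Fml → Set
  OpenC t (A ≼ B) = T (isC L) × (¬ SF.mem B (d t)) × (¬ SF.mem A (g t))
  OpenC t _ = ⊥

  Some : SF.Subset S → (Fml → Set) → Set
  Some s P = Σ Fml λ x → SF.mem x s × P x

  record Saturated (t : State) : Set where
    constructor saturated
    field
      no-impL : ¬ Some (g t) (OpenImpL t)
      no-impR : ¬ Some (d t) (OpenImpR t)
      no-prefR : ¬ Some (d t) (OpenPrefR t)
      no-prefL : ¬ Some (g t) (OpenPrefL t)
      no-N : ¬ OpenN t
      no-T : ¬ Some (g t) (OpenT t)
      no-W : ¬ OpenW t
      no-C : ¬ Some (g t) (OpenC t)

  OpenImpL? : ∀ t x → Dec (OpenImpL t x)
  OpenImpL? t (A ⇒ B) = ¬? (SF.mem? B (g t)) ×-dec ¬? (SF.mem? A (d t))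
  OpenImpL? t (atom _) = no λ ()
  OpenImpL? t falsum = no λ ()
  OpenImpL? t (_ ≼ _) = no λ ()

  OpenImpR? : ∀ t x → Dec (OpenImpR t x)
  OpenImpR? t (A ⇒ B) = ¬? (SF.mem? A (g t) ×-dec SF.mem? B (d t))
  OpenImpR? t (atom _) = no λ ()
  OpenImpR? t falsum = no λ ()
  OpenImpR? t (_ ≼ _) = no λ ()

  OpenPrefR? : ∀ t x → Dec (OpenPrefR t x)
  OpenPrefR? t (A ≼ B) = ¬? (SB.mem? _ (b t))
  OpenPrefR? t (atom _) = no λ ()
  OpenPrefR? t falsum = no λ ()
  OpenPrefR? t (_ ⇒ _) = no λ ()

  OpenPrefLAt? : ∀ t A B k → Dec (OpenPrefLAt t A B k)
  OpenPrefLAt? t A B (σ , C) = ¬? (SF.mem? B σ) ×-dec ¬? (SB.mem? _ (b t)) ×-dec ¬? (SB.mem? _ (b t))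

  OpenPrefL? : ∀ t x → Dec (OpenPrefL t x)
  OpenPrefL? t (A ≼ B) = SB.∃-mem? (OpenPrefLAt? t A B) (b t)
  OpenPrefL? t (atom _) = no λ ()
  OpenPrefL? t falsum = no λ ()
  OpenPrefL? t (_ ⇒ _) = no λ ()

  OpenN? : ∀ t → Dec (OpenN t)
  OpenN? t = T? _ ×-dec ¬? (SB.mem? _ (b t))

  OpenT? : ∀ t x → Dec (OpenT t x)
  OpenT? t (A ≼ B) = T? _ ×-dec ¬? (SF.mem? B (d t)) ×-dec ¬? (SB.mem? _ (b t))
  OpenT? t (atom _) = no λ ()
  OpenT? t falsum = no λ ()
  OpenT? t (_ ⇒ _) = no λ ()

  OpenWAt? : ∀ t k → Dec (OpenWAt t k)
  OpenWAt? t (σ , C) = SF.∃-mem? (λ a → ¬? (SF.mem? a (d t))) σ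

  OpenW? : ∀ t → Dec (OpenW t)
  OpenW? t = T? _ ×-dec SB.∃-mem? (OpenWAt? t) (b t)

  OpenC? : ∀ t x → Dec (OpenC t x)
  OpenC? t (A ≼ B) = T? _ ×-dec ¬? (SF.mem? B (d t)) ×-dec ¬? (SF.mem? A (g t))
  OpenC? t (atom _) = no λ ()
  OpenC? t falsum = no λ ()
  OpenC? t (_ ⇒ _) = no λ ()

  Some? : ∀ s {P : Fml → Set} → (∀ x → Dec (P x)) → Dec (Some s P)
  Some? s P? = SF.∃-mem? P? s

  measure : State → ℕ
  measure t = SF.gaps (g t) + (SF.gaps (d t) + SB.gaps (b t))

  measure-< : ∀ {t u} → t ⊑ u → (SF.gaps (g u) < SF.gaps (g t)) ⊎ ((SF.gaps (d u) < SF.gaps (d t)) ⊎ (SB.gaps (b u) < SB.gaps (b t))) → measure u < measure t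
  measure-< (p , q , r) (inj₁ x) = +-mono-<-≤ x (+-mono-≤ (SF.gaps-anti q) (SB.gaps-anti r))
  measure-< (p , q , r) (inj₂ (inj₁ x)) = +-mono-≤-< (SF.gaps-anti p) (+-mono-<-≤ x (SB.gaps-anti r))
  measure-< (p , q , r) (inj₂ (inj₂ x)) = +-mono-≤-< (SF.gaps-anti p) (+-mono-≤-< (SF.gaps-anti q) x)

  measure-insertG : ∀ t X → X ∈ S → ¬ SF.mem X (g t) → measure (setG t (SF.insert X (g t))) < measure t
  measure-insertG t X x nm = measure-< (SF.⊆-insert X (g t) , SF.⊆-refl (d t) , SB.⊆-refl (b t))
    (inj₁ (SF.gaps-< X (SF.⊆-insert X (g t)) (SF.mem-insert-self X (g t) x) nm))

  measure-insertD : ∀ t X → X ∈ S → ¬ SF.mem X (d t) → measure (setD t (SF.insert X (d t))) < measure t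
  measure-insertD t X x nm = measure-< (SF.⊆-refl (g t) , SF.⊆-insert X (d t) , SB.⊆-refl (b t))
    (inj₂ (inj₁ (SF.gaps-< X (SF.⊆-insert X (d t)) (SF.mem-insert-self X (d t) x) nm)))

  measure-insertB : ∀ t k → k ∈ blockUniverse → ¬ SB.mem k (b t) → measure (setB t (SB.insert k (b t))) < measure t
  measure-insertB t k x nm = measure-< (SF.⊆-refl (g t) , SF.⊆-refl (d t) , SB.⊆-insert k (b t))
    (inj₂ (inj₂ (SB.gaps-< k (SB.⊆-insert k (b t)) (SB.mem-insert-self k (b t) x) nm)))

  ⊑-insertG : ∀ t X → t ⊑ setG t (SF.insert X (g t))
  ⊑-insertG t X = SF.⊆-insert X (g t) , SF.⊆-refl (d t) , SB.⊆-refl (b t)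
  ⊑-insertD : ∀ t X → t ⊑ setD t (SF.insert X (d t))
  ⊑-insertD t X = SF.⊆-refl (g t) , SF.⊆-insert X (d t) , SB.⊆-refl (b t)
  ⊑-insertB : ∀ t k → t ⊑ setB t (SB.insert k (b t))
  ⊑-insertB t k = SF.⊆-refl (g t) , SF.⊆-refl (d t) , SB.⊆-insert k (b t)
  ⊑-∪D : ∀ t σ → t ⊑ setD t (d t SF.∪ σ)
  ⊑-∪D t σ = SF.⊆-refl (g t) , SF.⊆-∪ˡ (d t) σ , SB.⊆-refl (b t)

  -- Backward proof search from a state t: either every component realising t is derivable
  -- in every context F c, or the leaf handler produced an R at a saturated extension of t.
  module Search (C : Set) (F : C → Hyp) (R : Set) where

    Provable : State → Set
    Provable u = ∀ c ℓ → ℓ ≽ u → ⊢[ L ] (ℓ ∷ F c)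

    LeafHandler : State → Set
    LeafHandler t = ∀ v → Saturated v → t ⊑ v → Provable v ⊎ R

    LeafHandler-⊑ : ∀ {t u} → t ⊑ u → LeafHandler t → LeafHandler u
    LeafHandler-⊑ p lf v s q = lf v s (⊑-trans p q)

    byRule₂ : ∀ {a b t} → (Provable a → Provable b → Provable t) → Provable a ⊎ R → Provable b ⊎ R → Provable t ⊎ R
    byRule₂ f (inj₁ x) (inj₁ y) = inj₁ (f x y)
    byRule₂ f (inj₂ r) _ = inj₂ r
    byRule₂ f (inj₁ _) (inj₂ r) = inj₂ r

    byRule₁ : ∀ {a t} → (Provable a → Provable t) → Provable a ⊎ R → Provable t ⊎ R
    byRule₁ f (inj₁ x) = inj₁ (f x)
    byRule₁ f (inj₂ r) = inj₂ r

    ∈-skip : ∀ {i k k' : Item} {Δ'} → i ∈ (k ∷ Δ') → i ∈ (k ∷ k' ∷ Δ')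
    ∈-skip (here e) = here e
    ∈-skip (there x) = there (there x)

    ⇒L-step : ∀ t A B → SF.mem (A ⇒ B) (g t) → Provable (setG t (SF.insert B (g t))) → Provable (setD t (SF.insert A (d t))) → Provable t
    ⇒L-step t A B m q1 q2 c (Γ ⇛ Δ) h with ∈⇒∷↭ (proj₁ h _ m)
    ... | Γ' , pr = ex-Γ pr (⇒L (q1 c _ premise₁) (q2 c _ premise₂))
      where
      premise₁ : (B ∷ (A ⇒ B) ∷ Γ' ⇛ Δ) ≽ setG t (SF.insert B (g t))
      premise₁ = ≽-insertG B (≽-⊆c h ((λ a x → there (∈-resp-↭˘ pr a x)) , λ i x → x)) (here refl)
      premise₂ : ((A ⇒ B) ∷ Γ' ⇛ fml A ∷ Δ) ≽ setD t (SF.insert A (d t))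
      premise₂ = ≽-insertD A (≽-⊆c h (∈-resp-↭˘ pr , λ i x → there x)) (here refl)

    ⇒R-step : ∀ t A B → SF.mem (A ⇒ B) (d t) → Provable (state (SF.insert A (g t)) (SF.insert B (d t)) (b t)) → Provable t
    ⇒R-step t A B m q1 c (Γ ⇛ Δ) h with ∈⇒∷↭ (proj₁ (proj₂ h) _ m)
    ... | Δ' , pr = ex-Δ pr (⇒R (q1 c _ premise₁))
      where
      premise₁ : (A ∷ Γ ⇛ fml (A ⇒ B) ∷ fml B ∷ Δ') ≽ state (SF.insert A (g t)) (SF.insert B (d t)) (b t)
      premise₁ = ≽-insertD {t = setG t (SF.insert A (g t))} B
             (≽-insertG A (≽-⊆c h ((λ a x → there x) , λ i x → ∈-skip (∈-resp-↭˘ pr i x))) (here refl)) (there (here refl))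

    ≼R-step : ∀ t A B → SF.mem (A ≼ B) (d t) → Provable (setB t (SB.insert (single A , B) (b t))) → Provable t
    ≼R-step t A B m q1 c (Γ ⇛ Δ) h with ∈⇒∷↭ (proj₁ (proj₂ h) _ m)
    ... | Δ' , pr = ex-Δ pr (≼R (q1 c _ premise₁))
      where
      premise₁ : (Γ ⇛ fml (A ≼ B) ∷ blk (A ∷ []) B ∷ Δ') ≽ setB t (SB.insert (single A , B) (b t))
      premise₁ = ≽-insertB (single A) B (A ∷ []) (≽-⊆c h ((λ a x → x) , λ i x → ∈-skip (∈-resp-↭˘ pr i x))) (there (here refl))
             (λ a x → here (mem-single⁻ x))

    ≼L-step : ∀ t A B σ C' → SF.mem (A ≼ B) (g t) → SB.mem (σ , C') (b t) →
             Provable (setB t (SB.insert (SF.insert B σ , C') (b t))) → Provable (setB t (SB.insert (σ , A) (b t))) → Provable t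
    ≼L-step t A B σ C' mA mk q1 q2 c (Γ ⇛ Δ) h with proj₂ (proj₂ h) σ C' mk
    ... | Σl , bi , inc with ∈⇒∷↭ (proj₁ h _ mA) | ∈⇒∷↭ bi
    ...   | Γ' , prΓ | Δ' , prΔ = ex-Γ prΓ (ex-Δ prΔ (≼L (q1 c _ premise₁) (q2 c _ premise₂)))
      where
      premise₂ : ((A ≼ B) ∷ Γ' ⇛ blk Σl C' ∷ blk Σl A ∷ Δ') ≽ setB t (SB.insert (σ , A) (b t))
      premise₂ = ≽-insertB σ A Σl (≽-⊆c h (∈-resp-↭˘ prΓ , λ i x → ∈-skip (∈-resp-↭˘ prΔ i x))) (there (here refl)) inc
      premise₁⁰ : ((A ≼ B) ∷ Γ' ⇛ blk (B ∷ Σl) C' ∷ Δ') ≽ t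
      premise₁⁰ = (λ a x → ∈-resp-↭˘ prΓ a (proj₁ h a x)) , fd , fb
        where
        fd : ∀ a → SF.mem a (d t) → fml a ∈ (blk (B ∷ Σl) C' ∷ Δ')
        fd a x with ∈-resp-↭˘ prΔ _ (proj₁ (proj₂ h) a x)
        ... | here ()
        ... | there y = there y
        fb : ∀ τ D → SB.mem (τ , D) (b t) → Σ (List Fml) λ Σl' → (blk Σl' D ∈ (blk (B ∷ Σl) C' ∷ Δ')) × (∀ a → SF.mem a τ → a ∈ Σl')
        fb τ D x with proj₂ (proj₂ h) τ D x
        ... | Σl' , bi' , inc' with ∈-resp-↭˘ prΔ _ bi'
        ...   | here refl = (B ∷ Σl) , here refl , λ a y → there (inc' a y)
        ...   | there y = Σl' , there y , inc'
      ⊆-premise₁ : ∀ a → SF.mem a (SF.insert B σ) → a ∈ (B ∷ Σl)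
      ⊆-premise₁ a x with SF.mem-insert⁻ B a σ x
      ... | inj₁ y = there (inc a y)
      ... | inj₂ refl = here refl
      premise₁ : ((A ≼ B) ∷ Γ' ⇛ blk (B ∷ Σl) C' ∷ Δ') ≽ setB t (SB.insert (SF.insert B σ , C') (b t))
      premise₁ = ≽-insertB (SF.insert B σ) C' (B ∷ Σl) premise₁⁰ (here refl) ⊆-premise₁

    N-step : ∀ t → T (isN L) → Provable (setB t (SB.insert (single falsum , verum) (b t))) → Provable t
    N-step t hN q1 c (Γ ⇛ Δ) h = ruleN (hasN hN) (q1 c _ premise₁)
      where
      premise₁ : (Γ ⇛ blk (falsum ∷ []) verum ∷ Δ) ≽ setB t (SB.insert (single falsum , verum) (b t))
      premise₁ = ≽-insertB (single falsum) verum (falsum ∷ []) (≽-⊆c h ((λ a x → x) , λ i x → there x)) (here refl)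
             (λ a x → here (mem-single⁻ x))

    T-step : ∀ t A B → T (isT L) → SF.mem (A ≼ B) (g t) → Provable (setD t (SF.insert B (d t))) → Provable (setB t (SB.insert (single falsum , A) (b t))) → Provable t
    T-step t A B hT mA q1 q2 c (Γ ⇛ Δ) h with ∈⇒∷↭ (proj₁ h _ mA)
    ... | Γ' , pr = ex-Γ pr (ruleT (hasT hT) (q1 c _ premise₁) (q2 c _ premise₂))
      where
      premise₁ : ((A ≼ B) ∷ Γ' ⇛ fml B ∷ Δ) ≽ setD t (SF.insert B (d t))
      premise₁ = ≽-insertD B (≽-⊆c h (∈-resp-↭˘ pr , λ i x → there x)) (here refl)
      premise₂ : ((A ≼ B) ∷ Γ' ⇛ blk (falsum ∷ []) A ∷ Δ) ≽ setB t (SB.insert (single falsum , A) (b t))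
      premise₂ = ≽-insertB (single falsum) A (falsum ∷ []) (≽-⊆c h (∈-resp-↭˘ pr , λ i x → there x)) (here refl)
             (λ a x → here (mem-single⁻ x))

    W-step : ∀ t σ C' → T (isW L) → SB.mem (σ , C') (b t) → Provable (setD t (d t SF.∪ σ)) → Provable t
    W-step t σ C' hW mk q1 c (Γ ⇛ Δ) h with proj₂ (proj₂ h) σ C' mk
    ... | Σl , bi , inc with ∈⇒∷↭ bi
    ...   | Δ' , pr = ex-Δ pr (ruleW (hasW hW) (q1 c _ premise₁))
      where
      ∈-skipΣ : ∀ {i} → i ∈ (blk Σl C' ∷ Δ') → i ∈ (blk Σl C' ∷ (map fml Σl ++ Δ'))
      ∈-skipΣ (here e) = here e
      ∈-skipΣ (there x) = there (∈-++⁺ʳ _ x)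
      premise₁ : (Γ ⇛ blk Σl C' ∷ (map fml Σl ++ Δ')) ≽ setD t (d t SF.∪ σ)
      premise₁ = ≽-∪D σ (≽-⊆c h ((λ a x → x) , λ i x → ∈-skipΣ (∈-resp-↭˘ pr i x)))
             (λ a x → there (∈-++⁺ˡ (∈-map⁺ fml (inc a x))))

    C-step : ∀ t A B → T (isC L) → SF.mem (A ≼ B) (g t) → Provable (setD t (SF.insert B (d t))) → Provable (setG t (SF.insert A (g t))) → Provable t
    C-step t A B hC mA q1 q2 c (Γ ⇛ Δ) h with ∈⇒∷↭ (proj₁ h _ mA)
    ... | Γ' , pr = ex-Γ pr (ruleC (hasC hC) (q1 c _ premise₁) (q2 c _ premise₂))
      where
      premise₁ : ((A ≼ B) ∷ Γ' ⇛ fml B ∷ Δ) ≽ setD t (SF.insert B (d t))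
      premise₁ = ≽-insertD B (≽-⊆c h (∈-resp-↭˘ pr , λ i x → there x)) (here refl)
      premise₂ : (A ∷ (A ≼ B) ∷ Γ' ⇛ Δ) ≽ setG t (SF.insert A (g t))
      premise₂ = ≽-insertG A (≽-⊆c h ((λ a x → there (∈-resp-↭˘ pr a x)) , λ i x → x)) (here refl)

    Continuation : State → Set
    Continuation t = ∀ {t'} → t ⊑ t' → measure t' < measure t → Provable t' ⊎ R

    expandImpL : ∀ t → Continuation t → Some (g t) (OpenImpL t) → Provable t ⊎ R
    expandImpL t go ((A ⇒ B) , m , nB , nA) = byRule₂ (⇒L-step t A B m)
      (go (⊑-insertG t B) (measure-insertG t B (proj₂ (⇒-closed (mem⇒∈S (g t) m))) nB))
      (go (⊑-insertD t A) (measure-insertD t A (proj₁ (⇒-closed (mem⇒∈S (g t) m))) nA))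
    expandImpL t go (atom _ , _ , ())
    expandImpL t go (falsum , _ , ())
    expandImpL t go ((_ ≼ _) , _ , ())

    expandImpR : ∀ t → Continuation t → Some (d t) (OpenImpR t) → Provable t ⊎ R
    expandImpR t go ((A ⇒ B) , m , nv) = byRule₁ (⇒R-step t A B m) (go le decreases)
      where
      t' = state (SF.insert A (g t)) (SF.insert B (d t)) (b t)
      le : t ⊑ t'
      le = SF.⊆-insert A (g t) , SF.⊆-insert B (d t) , SB.⊆-refl (b t)
      decreases : measure t' < measure t
      decreases with SF.mem? A (g t) | SF.mem? B (d t)
      ... | no nA | _ = measure-< le (inj₁ (SF.gaps-< A (SF.⊆-insert A (g t)) (SF.mem-insert-self A (g t) (proj₁ (⇒-closed (mem⇒∈S (d t) m)))) nA))
      ... | yes mA | yes mB = ⊥-elim (nv (mA , mB))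
      ... | yes _ | no nB = measure-< le (inj₂ (inj₁ (SF.gaps-< B (SF.⊆-insert B (d t)) (SF.mem-insert-self B (d t) (proj₂ (⇒-closed (mem⇒∈S (d t) m)))) nB)))
    expandImpR t go (atom _ , _ , ())
    expandImpR t go (falsum , _ , ())
    expandImpR t go ((_ ≼ _) , _ , ())

    expandPrefR : ∀ t → Continuation t → Some (d t) (OpenPrefR t) → Provable t ⊎ R
    expandPrefR t go ((A ≼ B) , m , nv) = byRule₁ (≼R-step t A B m)
      (go (⊑-insertB t _) (measure-insertB t _ (∈-blockUniverse _ (proj₂ (≼-closed (mem⇒∈S (d t) m)))) nv))
    expandPrefR t go (atom _ , _ , ())
    expandPrefR t go (falsum , _ , ())
    expandPrefR t go ((_ ⇒ _) , _ , ())

    expandPrefL : ∀ t → Continuation t → Some (g t) (OpenPrefL t) → Provable t ⊎ R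
    expandPrefL t go ((A ≼ B) , m , (σ , C) , mk , nB , nBσ , nAσ) = byRule₂ (≼L-step t A B σ C m mk)
      (go (⊑-insertB t _) (measure-insertB t _ (∈-blockUniverse _ (block⇒∈S (b t) mk)) nBσ))
      (go (⊑-insertB t _) (measure-insertB t _ (∈-blockUniverse _ (proj₁ (≼-closed (mem⇒∈S (g t) m)))) nAσ))
    expandPrefL t go (atom _ , _ , ())
    expandPrefL t go (falsum , _ , ())
    expandPrefL t go ((_ ⇒ _) , _ , ())

    expandN : ∀ t → Continuation t → OpenN t → Provable t ⊎ R
    expandN t go (hN , nm) = byRule₁ (N-step t hN) (go (⊑-insertB t _) (measure-insertB t _ (∈-blockUniverse _ verum∈) nm))

    expandT : ∀ t → Continuation t → Some (g t) (OpenT t) → Provable t ⊎ R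
    expandT t go ((A ≼ B) , m , hT , nB , nk) = byRule₂ (T-step t A B hT m)
      (go (⊑-insertD t B) (measure-insertD t B (proj₂ (≼-closed (mem⇒∈S (g t) m))) nB))
      (go (⊑-insertB t _) (measure-insertB t _ (∈-blockUniverse _ (proj₁ (≼-closed (mem⇒∈S (g t) m)))) nk))
    expandT t go (atom _ , _ , ())
    expandT t go (falsum , _ , ())
    expandT t go ((_ ⇒ _) , _ , ())

    expandW : ∀ t → Continuation t → OpenW t → Provable t ⊎ R
    expandW t go (hW , (σ , C) , mk , a , ma , a∉d) = byRule₁ (W-step t σ C hW mk)
      (go (⊑-∪D t σ) (measure-< (⊑-∪D t σ) (inj₂ (inj₁ (SF.gaps-< a (SF.⊆-∪ˡ (d t) σ) (SF.mem-⊆ a (SF.⊆-∪ʳ (d t) σ) ma) a∉d)))))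

    expandC : ∀ t → Continuation t → Some (g t) (OpenC t) → Provable t ⊎ R
    expandC t go ((A ≼ B) , m , hC , nB , nA) = byRule₂ (C-step t A B hC m)
      (go (⊑-insertD t B) (measure-insertD t B (proj₂ (≼-closed (mem⇒∈S (g t) m))) nB))
      (go (⊑-insertG t A) (measure-insertG t A (proj₁ (≼-closed (mem⇒∈S (g t) m))) nA))
    expandC t go (atom _ , _ , ())
    expandC t go (falsum , _ , ())
    expandC t go ((_ ⇒ _) , _ , ())

    expand : ∀ t → Continuation t → (Saturated t → Provable t ⊎ R) → Provable t ⊎ R
    expand t go done with Some? (g t) (OpenImpL? t) | Some? (d t) (OpenImpR? t) | Some? (d t) (OpenPrefR? t)
                        | Some? (g t) (OpenPrefL? t) | OpenN? t | Some? (g t) (OpenT? t) | OpenW? t | Some? (g t) (OpenC? t)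
    ... | yes v | _ | _ | _ | _ | _ | _ | _ = expandImpL t go v
    ... | no _ | yes v | _ | _ | _ | _ | _ | _ = expandImpR t go v
    ... | no _ | no _ | yes v | _ | _ | _ | _ | _ = expandPrefR t go v
    ... | no _ | no _ | no _ | yes v | _ | _ | _ | _ = expandPrefL t go v
    ... | no _ | no _ | no _ | no _ | yes v | _ | _ | _ = expandN t go v
    ... | no _ | no _ | no _ | no _ | no _ | yes v | _ | _ = expandT t go v
    ... | no _ | no _ | no _ | no _ | no _ | no _ | yes v | _ = expandW t go v
    ... | no _ | no _ | no _ | no _ | no _ | no _ | no _ | yes v = expandC t go v
    ... | no n₁ | no n₂ | no n₃ | no n₄ | no n₅ | no n₆ | no n₇ | no n₈ = done (saturated n₁ n₂ n₃ n₄ n₅ n₆ n₇ n₈)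

    searchBelow : ∀ n t → measure t < n → LeafHandler t → Provable t ⊎ R
    searchBelow (suc n) t (s≤s lt) lf =
      expand t (λ le lt' → searchBelow n _ (<-≤-trans lt' lt) (LeafHandler-⊑ le lf)) (λ sat → lf t sat (⊑-refl t))

    search : ∀ t → LeafHandler t → Provable t ⊎ R
    search t = searchBelow (suc (measure t)) t ≤-refl

  toState : SF.Subset S × (SF.Subset S × SB.Subset blockUniverse) → State
  toState (x , y , z) = state x y z

  allStates : List State
  allStates = map toState (cartesianProduct (SF.allSubsets S) (cartesianProduct (SF.allSubsets S) (SB.allSubsets blockUniverse)))

  ∈-allStates : ∀ t → t ∈ allStates
  ∈-allStates (state x y z) = ∈-map⁺ toState (∈-cartesianProduct⁺ (SF.∈-allSubsets x) (∈-cartesianProduct⁺ (SF.∈-allSubsets y) (SB.∈-allSubsets z)))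

  Consistent : State → Set
  Consistent t = (¬ SF.mem falsum (g t)) × (¬ Some (g t) (λ x → IsAtom x × SF.mem x (d t)))

  Consistent? : ∀ t → Dec (Consistent t)
  Consistent? t = ¬? (SF.mem? falsum (g t)) ×-dec ¬? (Some? (g t) (λ x → IsAtom? x ×-dec SF.mem? x (d t)))

  Saturated? : ∀ t → Dec (Saturated t)
  Saturated? t = map′ (λ (a₁ , a₂ , a₃ , a₄ , a₅ , a₆ , a₇ , a₈) → saturated a₁ a₂ a₃ a₄ a₅ a₆ a₇ a₈)
    (λ s → let open Saturated s in no-impL , no-impR , no-prefR , no-prefL , no-N , no-T , no-W , no-C)
    (¬? (Some? (g t) (OpenImpL? t)) ×-dec ¬? (Some? (d t) (OpenImpR? t)) ×-dec ¬? (Some? (d t) (OpenPrefR? t))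
      ×-dec ¬? (Some? (g t) (OpenPrefL? t)) ×-dec ¬? (OpenN? t) ×-dec ¬? (Some? (g t) (OpenT? t))
      ×-dec ¬? (OpenW? t) ×-dec ¬? (Some? (g t) (OpenC? t)))

  prefs : SF.Subset S → SF.Subset S
  prefs = SF.restrict isPref

  AgreeOnPrefs : State → State → Set
  AgreeOnPrefs u s = (prefs (g u) ≡ prefs (g s)) × (prefs (d u) ≡ prefs (d s))

  AgreeOnPrefs? : ∀ u s → Dec (AgreeOnPrefs u s)
  AgreeOnPrefs? u s = prefs (g u) SF.≟ˢ prefs (g s) ×-dec prefs (d u) SF.≟ˢ prefs (d s)

  -- Under (A) the worlds in a neighbourhood of w have the neighbourhoods of w, hence force
  -- the same ≼-formulas; so in the logics with A witnesses must agree with their source on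
  -- ≼-formulas.
  AgreeIfA : State → State → Set
  AgreeIfA s u = T (isA L) → AgreeOnPrefs u s

  AgreeIfA? : ∀ s u → Dec (AgreeIfA s u)
  AgreeIfA? s u = T? (isA L) →-dec AgreeOnPrefs? u s

  AgreeIfA-trans : ∀ {s v u} → AgreeIfA s v → AgreeIfA v u → AgreeIfA s u
  AgreeIfA-trans p q h = trans (proj₁ (q h)) (proj₁ (p h)) , trans (proj₂ (q h)) (proj₂ (p h))

  Witness : (State → Set) → State → Block → State → Set
  Witness P s (σ , D) u = P u × SF.mem D (g u) × (σ SF.⊆ d u) × AgreeIfA s u

  -- Each round can only discard states, so on the finite set of states
  -- the rounds stabilise.
  Survives : ℕ → State → Set
  Survives zero t = Saturated t × Consistent t
  Survives (suc k) t = Survives k t × (∀ kb → SB.mem kb (b t) → Any (Witness (Survives k) t kb) allStates)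

  mutual
    Survives? : ∀ k t → Dec (Survives k t)
    Survives? zero t = Saturated? t ×-dec Consistent? t
    Survives? (suc k) t = Survives? k t ×-dec SB.∀-mem? (λ kb → any? (Witness? k t kb) allStates) (b t)

    Witness? : ∀ k t kb u → Dec (Witness (Survives k) t kb u)
    Witness? k t (σ , D) u = Survives? k u ×-dec SF.mem? D (g u) ×-dec σ SF.⊆? d u ×-dec AgreeIfA? t u

  stabilisesBelow : ∀ f k → count (Survives? k) allStates < f → Σ ℕ λ K → ∀ u → Survives K u → Survives (suc K) u
  stabilisesBelow (suc f) k (s≤s lt) with any? (λ u → ¬? (Survives? k u →-dec Survives? (suc k) u)) allStates
  ... | no stable = k , λ u x → decidable-stable (Survives? (suc k) u) λ ny → stable (lose (∈-allStates u) λ f → ny (f x))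
  ... | yes unstable with find unstable
  ...   | u , m , bad with Survives? k u | Survives? (suc k) u
  ...     | no nx | _ = ⊥-elim (bad (λ x → ⊥-elim (nx x)))
  ...     | yes _ | yes y = ⊥-elim (bad (λ _ → y))
  ...     | yes x | no ny = stabilisesBelow f (suc k) (<-≤-trans (count-< (Survives? (suc k)) (Survives? k) (λ _ → proj₁) allStates m x ny) lt)

  stabilises : Σ ℕ λ K → ∀ u → Survives K u → Survives (suc K) u
  stabilises = stabilisesBelow (suc (count (Survives? 0) allStates)) 0 ≤-refl

  Derivable : State → Set
  Derivable t = ∀ G ℓ → ℓ ≽ t → ⊢[ L ] (ℓ ∷ G)

  DerivableNear : State → State → Set
  DerivableNear s v = ∀ G ℓ → ℓ ≽ v → (ℓ ≽ s ⊎ Any (_≽ s) G) → ⊢[ L ] (ℓ ∷ G)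

  Survivor : ℕ → State → Set
  Survivor K t = Σ State λ u → Survives K u × (t ⊑ u)

  inconsistent⇒derivable : ∀ v → ¬ Consistent v → Derivable v
  inconsistent⇒derivable v ncs G (Γ ⇛ Δ) h with SF.mem? falsum (g v)
  ... | yes mf = ex-Γ (proj₂ (∈⇒∷↭ (proj₁ h _ mf))) ⊥L
  ... | no nf with Some? (g v) (λ x → IsAtom? x ×-dec SF.mem? x (d v))
  ...   | no ne = ⊥-elim (ncs (nf , ne))
  ...   | yes (.(atom p) , mg , (p , refl) , md) with ∈⇒∷↭ (proj₁ h _ mg) | ∈⇒∷↭ (proj₁ (proj₂ h) _ md)
  ...     | Γ' , pΓ | Δ' , pΔ = ex-Γ pΓ (ex-Δ pΔ init)

  prefGaps : State → ℕ
  prefGaps t = SF.gaps (prefs (g t)) + SF.gaps (prefs (d t))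

  prefGaps-anti : ∀ {t v} → t ⊑ v → prefGaps v ≤ prefGaps t
  prefGaps-anti (p , q , r) = +-mono-≤ (SF.gaps-anti (SF.restrict-mono isPref p)) (SF.gaps-anti (SF.restrict-mono isPref q))

  prefs-⊆ : ∀ {x y} → prefs x SF.⊆ y → prefs x SF.⊆ prefs y
  prefs-⊆ {x} {y} p = subst (SF._⊆ prefs y) (SF.restrict-idem isPref x) (SF.restrict-mono isPref p)

  prefs-∪-settled : ∀ x z y → prefs z ≡ prefs x → prefs z SF.⊆ y → prefs (x SF.∪ prefs y) ≡ prefs x → prefs y ≡ prefs z
  prefs-∪-settled x z y zx zy e = SF.⊆-antisym (subst (prefs y SF.⊆_) (trans e (sym zx)) (prefs-⊆ (SF.⊆-∪ʳ x (prefs y)))) (prefs-⊆ zy)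

  addPrefs : State → State → State
  addPrefs s v = state (g s SF.∪ prefs (g v)) (d s SF.∪ prefs (d v)) (b s)

  ⊑-addPrefs : ∀ s v → s ⊑ addPrefs s v
  ⊑-addPrefs s v = SF.⊆-∪ˡ (g s) _ , SF.⊆-∪ˡ (d s) _ , SB.⊆-refl (b s)

  prefs-⊆-addPrefs : ∀ s w → (prefs (g s) SF.⊆ prefs (g (addPrefs s w))) × (prefs (d s) SF.⊆ prefs (d (addPrefs s w)))
  prefs-⊆-addPrefs s w = SF.restrict-mono isPref (SF.⊆-∪ˡ (g s) _) , SF.restrict-mono isPref (SF.⊆-∪ˡ (d s) _)

  prefGaps-addPrefs : ∀ s v w → AgreeOnPrefs v s → prefs (g v) SF.⊆ g w → prefs (d v) SF.⊆ d w → ¬ AgreeOnPrefs w v →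
                      prefGaps (addPrefs s w) < prefGaps s
  prefGaps-addPrefs s v w (eg , ed) vg vd disagree
    with prefs (g (addPrefs s w)) SF.≟ˢ prefs (g s) | prefs (d (addPrefs s w)) SF.≟ˢ prefs (d s)
  ... | no ne | _ = +-mono-<-≤ (SF.gaps-<-≢ (proj₁ (prefs-⊆-addPrefs s w)) (λ e → ne (sym e))) (SF.gaps-anti (proj₂ (prefs-⊆-addPrefs s w)))
  ... | yes _ | no ne = +-mono-≤-< (SF.gaps-anti (proj₁ (prefs-⊆-addPrefs s w))) (SF.gaps-<-≢ (proj₂ (prefs-⊆-addPrefs s w)) (λ e → ne (sym e)))
  ... | yes sg | yes sd = ⊥-elim (disagree (prefs-∪-settled (g s) (g v) (g w) eg vg sg , prefs-∪-settled (d s) (d v) (d w) ed vd sd))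

  copyPrefsL : HasA L → ∀ (Xs : List Fml) → (∀ a → a ∈ Xs → IsPref a) → ∀ {Γs Δs Γt Δt G} →
               (∀ a → a ∈ Xs → a ∈ Γs) → ⊢[ L ] ((Γs ⇛ Δs) ∷ (Xs ++ Γt ⇛ Δt) ∷ G) → ⊢[ L ] ((Γs ⇛ Δs) ∷ (Γt ⇛ Δt) ∷ G)
  copyPrefsL hA [] ip inc D = D
  copyPrefsL hA (x ∷ Xs) ip {Γs} {Δs} {Γt} {Δt} {G} inc D =
    copyPrefsL hA Xs (λ a m → ip a (there m)) (λ a m → inc a (there m)) (step x (ip x (here refl)) (inc x (here refl)) D)
    where
    step : ∀ x → IsPref x → x ∈ Γs → ⊢[ L ] ((Γs ⇛ Δs) ∷ (x ∷ (Xs ++ Γt) ⇛ Δt) ∷ G) → ⊢[ L ] ((Γs ⇛ Δs) ∷ ((Xs ++ Γt) ⇛ Δt) ∷ G)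
    step (A ≼ B) _ m D with ∈⇒∷↭ m
    ... | Γs' , pr = ex-Γ pr (ruleAL hA (ex-Γ (↭-sym pr) D))

  copyPrefsR : HasA L → ∀ (Xs : List Fml) → (∀ a → a ∈ Xs → IsPref a) → ∀ {Γs Δs Γt Δt G} →
               (∀ a → a ∈ Xs → fml a ∈ Δs) → ⊢[ L ] ((Γs ⇛ Δs) ∷ (Γt ⇛ map fml Xs ++ Δt) ∷ G) → ⊢[ L ] ((Γs ⇛ Δs) ∷ (Γt ⇛ Δt) ∷ G)
  copyPrefsR hA [] ip inc D = D
  copyPrefsR hA (x ∷ Xs) ip {Γs} {Δs} {Γt} {Δt} {G} inc D =
    copyPrefsR hA Xs (λ a m → ip a (there m)) (λ a m → inc a (there m)) (step x (ip x (here refl)) (inc x (here refl)) D)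
    where
    step : ∀ x → IsPref x → fml x ∈ Δs → ⊢[ L ] ((Γs ⇛ Δs) ∷ (Γt ⇛ fml x ∷ (map fml Xs ++ Δt)) ∷ G) → ⊢[ L ] ((Γs ⇛ Δs) ∷ (Γt ⇛ (map fml Xs ++ Δt)) ∷ G)
    step (A ≼ B) _ m D with ∈⇒∷↭ m
    ... | Δs' , pr = ex-Δ pr (ruleAR hA (ex-Δ (↭-sym pr) D))

  prefList : SF.Subset S → List Fml
  prefList x = SF.toList (prefs x)

  ∈-prefList⁺ : ∀ x a → SF.mem a (prefs x) → a ∈ prefList x
  ∈-prefList⁺ x a m = SF.∈-toList⁺ a _ m

  ∈-prefList⁻ : ∀ x a → a ∈ prefList x → IsPref a × SF.mem a x
  ∈-prefList⁻ x a m = SF.mem-restrict⁻ isPref a x (SF.∈-toList⁻ a _ m)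

  copyPrefs : HasA L → ∀ x y {Γs Δs Γt Δt G} → (∀ a → SF.mem a x → a ∈ Γs) → (∀ a → SF.mem a y → fml a ∈ Δs) →
              ⊢[ L ] ((Γs ⇛ Δs) ∷ (prefList x ++ Γt ⇛ map fml (prefList y) ++ Δt) ∷ G) → ⊢[ L ] ((Γs ⇛ Δs) ∷ (Γt ⇛ Δt) ∷ G)
  copyPrefs hA x y ix iy D =
    copyPrefsR hA (prefList y) (λ a m → proj₁ (∈-prefList⁻ y a m)) (λ a m → iy a (proj₂ (∈-prefList⁻ y a m)))
      (copyPrefsL hA (prefList x) (λ a m → proj₁ (∈-prefList⁻ x a m)) (λ a m → ix a (proj₂ (∈-prefList⁻ x a m))) D)

  derivable-addPrefs : HasA L → ∀ {s v} → Derivable (addPrefs s v) → ∀ G ℓ → ℓ ≽ v → Any (_≽ s) G → ⊢[ L ] (ℓ ∷ G)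
  derivable-addPrefs hA {s} {v} der G ℓ ℓv near with Any⇒∷↭ near
  ... | (Γr ⇛ Δr) , G' , rs , pr =
    ex-H (↭-prep _ pr) (copyPrefs hA (g v) (d v) (proj₁ ℓv) (proj₁ (proj₂ ℓv))
      (ex-H (↭-swap _ _ ↭-refl) (der (ℓ ∷ G') _ realises)))
    where
    realises : (prefList (g v) ++ Γr ⇛ map fml (prefList (d v)) ++ Δr) ≽ addPrefs s v
    realises = fg , fd , λ τ E m → let Σl , bi , inc = proj₂ (proj₂ rs) τ E m in Σl , ∈-++⁺ʳ _ bi , inc
      where
      fg : ∀ a → SF.mem a (g (addPrefs s v)) → a ∈ (prefList (g v) ++ Γr)
      fg a m with SF.mem-∪⁻ a (g s) _ m
      ... | inj₁ m' = ∈-++⁺ʳ _ (proj₁ rs a m')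
      ... | inj₂ m' = ∈-++⁺ˡ (∈-prefList⁺ (g v) a m')
      fd : ∀ a → SF.mem a (d (addPrefs s v)) → fml a ∈ (map fml (prefList (d v)) ++ Δr)
      fd a m with SF.mem-∪⁻ a (d s) _ m
      ... | inj₁ m' = ∈-++⁺ʳ _ (proj₁ (proj₂ rs) a m')
      ... | inj₂ m' = ∈-++⁺ˡ (∈-map⁺ fml (∈-prefList⁺ (d v) a m'))

  prefsIfA : Bool → SF.Subset S → SF.Subset S
  prefsIfA true x = prefs x
  prefsIfA false x = SF.empty

  prefListIfA : Bool → SF.Subset S → List Fml
  prefListIfA true x = prefList x
  prefListIfA false x = []

  ∈-prefListIfA⁺ : ∀ bA x a → SF.mem a (prefsIfA bA x) → a ∈ prefListIfA bA x
  ∈-prefListIfA⁺ true x a m = ∈-prefList⁺ x a m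
  ∈-prefListIfA⁺ false x a m = ⊥-elim (SF.¬mem-empty a m)

  prefs-⊆-prefsIfA : ∀ bA x → T bA → prefs x SF.⊆ prefsIfA bA x
  prefs-⊆-prefsIfA true x _ = SF.⊆-refl (prefs x)

  copyPrefsIfA : ∀ bA → (T bA → HasA L) → ∀ x y {Γs Δs Γt Δt G} → (∀ a → SF.mem a x → a ∈ Γs) → (∀ a → SF.mem a y → fml a ∈ Δs) →
                 ⊢[ L ] ((Γs ⇛ Δs) ∷ (prefListIfA bA x ++ Γt ⇛ map fml (prefListIfA bA y) ++ Δt) ∷ G) → ⊢[ L ] ((Γs ⇛ Δs) ∷ (Γt ⇛ Δt) ∷ G)
  copyPrefsIfA true hA = copyPrefs (hA tt)
  copyPrefsIfA false _ x y ix iy D = D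

  blockTarget : State → Block → State
  blockTarget v (σ , D) = state (SF.insert D (prefsIfA (isA L) (g v))) (σ SF.∪ prefsIfA (isA L) (d v)) SB.empty

  prefs-⊆-blockTarget : ∀ v σ D → T (isA L) →
                        (prefs (g v) SF.⊆ g (blockTarget v (σ , D))) × (prefs (d v) SF.⊆ d (blockTarget v (σ , D)))
  prefs-⊆-blockTarget v σ D hA = SF.⊆-trans (prefs-⊆-prefsIfA _ (g v) hA) (SF.⊆-insert D _)
                               , SF.⊆-trans (prefs-⊆-prefsIfA _ (d v) hA) (SF.⊆-∪ʳ σ _)

  -- A block of v without witness is reduced by jp to the search for its premise (plus, with
  -- A, the ≼-formulas of v).  That search succeeds, or reaches states that are eliminated
  -- in fewer rounds, or states disagreeing with v on ≼-formulas, whose ≼-formulas are then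
  -- added to s; this happens only finitely often since `prefGaps` decreases.
  module Elimination (K : ℕ) (s : State) (rec : ∀ t → prefGaps t < prefGaps s → Derivable t ⊎ Survivor K t) where

    record Context : Set where
      constructor context
      field
        rest : Hyp
        comp : Comp
        near : comp ≽ s ⊎ Any (_≽ s) rest
    open Context

    anyNear : (c : Context) → Any (_≽ s) (comp c ∷ rest c)
    anyNear c with near c
    ... | inj₁ h = here h
    ... | inj₂ a = there a

    open Search Context (λ c → comp c ∷ rest c) (Survivor K s)

    jump : ∀ v σ D → SB.mem (σ , D) (b v) → Provable (blockTarget v (σ , D)) → DerivableNear s v
    jump v σ D mk prem G (Γv ⇛ Δv) hv hr with proj₂ (proj₂ hv) σ D mk
    ... | Σl , bi , inc with ∈⇒∷↭ bi
    ...   | Δ' , prΔ = ex-Δ prΔ (jp (copyPrefsIfA (isA L) hasA (g v) (d v) (proj₁ hv') (proj₁ (proj₂ hv'))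
                          (ex-H (↭-swap premise ℓ ↭-refl) (prem (context G ℓ near') premise realises))))
      where
      ℓ : Comp
      ℓ = Γv ⇛ blk Σl D ∷ Δ'
      ℓ⊇ : (Γv ⇛ Δv) ⊆c ℓ
      ℓ⊇ = (λ a x → x) , ∈-resp-↭˘ prΔ
      hv' : ℓ ≽ v
      hv' = ≽-⊆c hv ℓ⊇
      near' : ℓ ≽ s ⊎ Any (_≽ s) G
      near' = map₁ (λ h → ≽-⊆c h ℓ⊇) hr
      premise : Comp
      premise = prefListIfA (isA L) (g v) ++ D ∷ [] ⇛ map fml (prefListIfA (isA L) (d v)) ++ map fml Σl
      realises : premise ≽ blockTarget v (σ , D)
      realises = fg , fd , λ τ E m → ⊥-elim (SB.¬mem-empty _ m)
        where
        fg : ∀ a → SF.mem a (g (blockTarget v (σ , D))) → a ∈ Comp.ant premise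
        fg a m with SF.mem-insert⁻ D a _ m
        ... | inj₁ m' = ∈-++⁺ˡ (∈-prefListIfA⁺ (isA L) (g v) a m')
        ... | inj₂ refl = ∈-++⁺ʳ _ (here refl)
        fd : ∀ a → SF.mem a (d (blockTarget v (σ , D))) → fml a ∈ Comp.suc premise
        fd a m with SF.mem-∪⁻ a σ _ m
        ... | inj₁ m' = ∈-++⁺ʳ _ (∈-map⁺ fml (inc a m'))
        ... | inj₂ m' = ∈-++⁺ˡ (∈-map⁺ fml (∈-prefListIfA⁺ (isA L) (d v) a m'))

    grow : ∀ v σ D w → AgreeIfA s v → blockTarget v (σ , D) ⊑ w → ¬ AgreeIfA v w → Provable w ⊎ Survivor K s
    grow v σ D w agree tw disagree with T? (isA L)
    ... | no nA = ⊥-elim (disagree (λ h → ⊥-elim (nA h)))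
    ... | yes hA with rec (addPrefs s w) (prefGaps-addPrefs s v w (agree hA)
                          (SF.⊆-trans (proj₁ (prefs-⊆-blockTarget v σ D hA)) (proj₁ tw))
                          (SF.⊆-trans (proj₂ (prefs-⊆-blockTarget v σ D hA)) (proj₁ (proj₂ tw)))
                          (λ ag → disagree (λ _ → ag)))
    ...   | inj₁ der = inj₁ λ c ℓ h → derivable-addPrefs (hasA hA) der (comp c ∷ rest c) ℓ h (anyNear c)
    ...   | inj₂ (u , xu , le) = inj₂ (u , xu , ⊑-trans (⊑-addPrefs s w) le)

    mutual
      eliminate : ∀ k v → Saturated v → AgreeIfA s v → ¬ Survives k v → DerivableNear s v ⊎ Survivor K s
      eliminate zero v sv agree nx = inj₁ λ G ℓ h _ → inconsistent⇒derivable v (λ c → nx (sv , c)) G ℓ h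
      eliminate (suc k) v sv agree nx with Survives? k v
      ... | no nxk = eliminate k v sv agree nxk
      ... | yes xk with SB.∃-mem? (λ kb → ¬? (any? (Witness? k v kb) allStates)) (b v)
      ...   | no nob = ⊥-elim (nx (xk , λ kb mk → decidable-stable (any? (Witness? k v kb) allStates) (λ nany → nob (kb , mk , nany))))
      ...   | yes ((σ , D) , mk , nwit) = unwitnessed k v sv agree σ D mk nwit

      unwitnessed : ∀ k v → Saturated v → AgreeIfA s v → ∀ σ D → SB.mem (σ , D) (b v) →
                    ¬ Any (Witness (Survives k) v (σ , D)) allStates → DerivableNear s v ⊎ Survivor K s
      unwitnessed k v sv agree σ D mk nwit = map₁ (jump v σ D mk) (search (blockTarget v (σ , D)) leaf)
        where
        leaf : LeafHandler (blockTarget v (σ , D))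
        leaf w sw tw with AgreeIfA? v w
        ... | no disagree = grow v σ D w agree tw disagree
        ... | yes agree' with Survives? k w
        ...   | yes xw = ⊥-elim (nwit (lose (∈-allStates w) (xw , D∈w , σ⊆w , agree')))
          where
          D∈w : SF.mem D (g w)
          D∈w = SF.mem-⊆ D (proj₁ tw) (SF.mem-insert-self D _ (block⇒∈S (b v) mk))
          σ⊆w : σ SF.⊆ d w
          σ⊆w = SF.⊆-trans (SF.⊆-∪ˡ σ _) (proj₁ (proj₂ tw))
        ...   | no nxw with eliminate k w sw (AgreeIfA-trans {s} {v} {w} agree agree') nxw
        ...     | inj₁ der = inj₁ λ c ℓ h → der (comp c ∷ rest c) ℓ h (inj₂ (anyNear c))
        ...     | inj₂ sur = inj₂ sur

  derivableOrSurvivorBelow : ∀ K f t → prefGaps t < f → Derivable t ⊎ Survivor K t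
  derivableOrSurvivorBelow K (suc f) t (s≤s lt) = Search.search Hyp (λ G → G) (Survivor K t) t leaf
    where
    leaf : Search.LeafHandler Hyp (λ G → G) (Survivor K t) t
    leaf v sv tv with Survives? K v
    ... | yes xv = inj₂ (v , xv , tv)
    ... | no nxv with Elimination.eliminate K v (λ t' lt' → derivableOrSurvivorBelow K f t' (<-≤-trans lt' (≤-trans (prefGaps-anti tv) lt)))
                        K v sv (λ _ → refl , refl) nxv
    ...   | inj₁ der = inj₁ (λ G ℓ h → der G ℓ h (inj₁ h))
    ...   | inj₂ (u , xu , vu) = inj₂ (u , xu , ⊑-trans tv vu)

  derivableOrSurvivor : ∀ K t → Derivable t ⊎ Survivor K t
  derivableOrSurvivor K t = derivableOrSurvivorBelow K (suc (prefGaps t)) t ≤-refl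

  Survives⇒Survives₀ : ∀ k {u} → Survives k u → Survives 0 u
  Survives⇒Survives₀ zero x = x
  Survives⇒Survives₀ (suc k) x = Survives⇒Survives₀ k (proj₁ x)

  -- A block (σ , C) of u is closed when ≼L cannot extend it: for each A ≼ B in g u, B is in σ
  -- or (σ , A) is a block.
  ClosedAt : State → SF.Subset S → Fml → Set
  ClosedAt u σ (A ≼ B) = SF.mem B σ ⊎ SB.mem (σ , A) (b u)
  ClosedAt u σ _ = ⊤

  ClosedAt? : ∀ u σ x → Dec (ClosedAt u σ x)
  ClosedAt? u σ (A ≼ B) = SF.mem? B σ ⊎-dec SB.mem? (σ , A) (b u)
  ClosedAt? u σ (atom _) = yes tt
  ClosedAt? u σ falsum = yes tt
  ClosedAt? u σ (_ ⇒ _) = yes tt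

  Closed : State → SF.Subset S → Set
  Closed u σ = ∀ x → SF.mem x (g u) → ClosedAt u σ x

  closeBelow : ∀ n u → Saturated u → ∀ σ C → SF.gaps σ < n → SB.mem (σ , C) (b u) →
               Σ (SF.Subset S) λ σ' → (σ SF.⊆ σ') × SB.mem (σ' , C) (b u) × Closed u σ'
  closeBelow zero u su σ C () m
  closeBelow (suc n) u su σ C (s≤s lt) m with SF.∃-mem? (λ x → ¬? (ClosedAt? u σ x)) (g u)
  ... | no nv = σ , SF.⊆-refl σ , m , λ x mx → decidable-stable (ClosedAt? u σ x) (λ ncl → nv (x , mx , ncl))
  ... | yes (x , mx , ncl) = closeAt x mx ncl
    where
    closeAt : ∀ x → SF.mem x (g u) → ¬ ClosedAt u σ x → Σ (SF.Subset S) λ σ' → (σ SF.⊆ σ') × SB.mem (σ' , C) (b u) × Closed u σ'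
    closeAt (A ≼ B) mx ncl with SB.mem? (SF.insert B σ , C) (b u)
    ... | no nm = ⊥-elim (Saturated.no-prefL su ((A ≼ B) , mx , (σ , C) , m , (λ p → ncl (inj₁ p)) , nm , (λ q → ncl (inj₂ q))))
    ... | yes m' with SF.mem? B σ
    ...   | yes p = ⊥-elim (ncl (inj₁ p))
    ...   | no np with closeBelow n u su (SF.insert B σ) C
                        (<-≤-trans (SF.gaps-< B (SF.⊆-insert B σ) (SF.mem-insert-self B σ (proj₂ (≼-closed (mem⇒∈S (g u) mx)))) np) lt) m'
    ...     | σ' , le , m'' , cl = σ' , SF.⊆-trans (SF.⊆-insert B σ) le , m'' , cl
    closeAt (atom _) mx ncl = ⊥-elim (ncl tt)
    closeAt falsum mx ncl = ⊥-elim (ncl tt)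
    closeAt (_ ⇒ _) mx ncl = ⊥-elim (ncl tt)

  close : ∀ u → Saturated u → ∀ σ C → SB.mem (σ , C) (b u) →
          Σ (SF.Subset S) λ σ' → (σ SF.⊆ σ') × SB.mem (σ' , C) (b u) × Closed u σ'
  close u su σ C m = closeBelow (suc (SF.gaps σ)) u su σ C ≤-refl m

  AgreeOnPrefs-sym : ∀ u v → AgreeOnPrefs u v → AgreeOnPrefs v u
  AgreeOnPrefs-sym u v (eg , ed) = sym eg , sym ed

  AgreeOnPrefs-trans : ∀ u v x → AgreeOnPrefs u v → AgreeOnPrefs v x → AgreeOnPrefs u x
  AgreeOnPrefs-trans u v x (eg , ed) (eg' , ed') = trans eg eg' , trans ed ed'

  SameClusterIf : Bool → State → State → Set
  SameClusterIf true w u = AgreeOnPrefs u w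
  SameClusterIf false w u = u ≡ w

  SameClusterIf-refl : ∀ bA w → SameClusterIf bA w w
  SameClusterIf-refl true w = refl , refl
  SameClusterIf-refl false w = refl

  SameClusterIf-pref : ∀ bA {w u} A B → SameClusterIf bA w u → SF.mem (A ≼ B) (g w) → SF.mem (A ≼ B) (g u)
  SameClusterIf-pref true {w} {u} A B (eg , ed) m =
    proj₂ (SF.mem-restrict⁻ isPref _ (g u) (subst (SF.mem (A ≼ B)) (sym eg) (SF.mem-restrict⁺ isPref _ (g w) tt m)))
  SameClusterIf-pref false A B refl m = m

  SameClusterIf-true : ∀ bA {w u} → T bA → SameClusterIf bA w u ⇔ AgreeOnPrefs u w
  SameClusterIf-true true _ = mk⇔ (λ c → c) (λ c → c)

  SameCluster : State → State → Set
  SameCluster = SameClusterIf (isA L)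

  SameCluster-W : ∀ L' {w u} → T (isW L') → SameClusterIf (isA L') w u → u ≡ w
  SameCluster-W LNW _ e = e
  SameCluster-W LNC _ e = e

  W-block⊆d : ∀ {t} → Saturated t → T (isW L) → ∀ σ C → SB.mem (σ , C) (b t) → ∀ a → SF.mem a σ → SF.mem a (d t)
  W-block⊆d {t} st' hW σ C mk a ma = decidable-stable (SF.mem? a (d t)) (λ na' → Saturated.no-W st' (hW , (σ , C) , mk , a , ma , na'))

  module Countermodel (K : ℕ) (stable : ∀ u → Survives K u → Survives (suc K) u) (w₀ : Σ State (Survives K)) where

    World : Set
    World = Σ State (Survives K)

    world-saturated : ∀ {u} → Survives K u → Saturated u
    world-saturated p = proj₁ (Survives⇒Survives₀ K p)

    world-consistent : ∀ {u} → Survives K u → Consistent u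
    world-consistent p = proj₂ (Survives⇒Survives₀ K p)

    world-witness : ∀ {u} → Survives K u → ∀ σ C → SB.mem (σ , C) (b u) → Σ State λ z → Survives K z × SF.mem C (g z) × (σ SF.⊆ d z) × AgreeIfA u z
    world-witness {u} p σ C m with find (proj₂ (stable u p) (σ , C) m)
    ... | z , _ , xz , mc , sd , po = z , xz , mc , sd , po

    -- The neighbourhoods of w: for each closed block (σ , C) of a state in the cluster of w,
    -- the worlds witnessing a closed block of the cluster that extends σ (with w itself
    -- added in logics with W); byT and byC provide those demanded by (T) and (C).
    InNbhd : State → SF.Subset S → State → Set
    InNbhd w σ v = Σ State λ u' → Survives K u' × SameCluster w u' × Σ (SF.Subset S) λ σ' → Σ Fml λ D' →
                   SB.mem (σ' , D') (b u') × Closed u' σ' × (σ SF.⊆ σ') × SF.mem D' (g v) × (σ' SF.⊆ d v) × AgreeIfA u' v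

    data NbhdCode (w : World) : Set where
      byBlock : ∀ u → Survives K u → SameCluster (proj₁ w) u → ∀ σ C → SB.mem (σ , C) (b u) → Closed u σ → NbhdCode w
      byT : T (isT L) → NbhdCode w
      byC : T (isC L) → NbhdCode w

    ⟦_⟧ : ∀ {w} → NbhdCode w → World → Set
    ⟦_⟧ {w} (byBlock u _ _ σ _ _ _) v = InNbhd (proj₁ w) σ (proj₁ v) ⊎ (T (isW L) × (v ≡ w))
    ⟦_⟧ {w} (byT _) v = (v ≡ w) ⊎ InNbhd (proj₁ w) SF.empty (proj₁ v)
    ⟦_⟧ {w} (byC _) v = v ≡ w

    witness-InNbhd : ∀ w u → Survives K u → SameCluster w u → ∀ σ C → SB.mem (σ , C) (b u) → Closed u σ → ∀ σ₀ → σ₀ SF.⊆ σ →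
                     Σ World λ z → InNbhd w σ₀ (proj₁ z) × SF.mem C (g (proj₁ z))
    witness-InNbhd w u gu cl σ C m clσ σ₀ le with world-witness gu σ C m
    ... | z , gz , mc , sd , po = (z , gz) , (u , gu , cl , σ , C , m , clσ , le , mc , sd , po) , mc

    ⟦⟧-nonempty : ∀ {w} (ns : NbhdCode w) → Σ World ⟦ ns ⟧
    ⟦⟧-nonempty {w} (byBlock u gu cl σ C m clσ) with witness-InNbhd (proj₁ w) u gu cl σ C m clσ σ (SF.⊆-refl σ)
    ... | z , i , _ = z , inj₁ i
    ⟦⟧-nonempty {w} (byT _) = w , inj₁ refl
    ⟦⟧-nonempty {w} (byC _) = w , refl

    Nbhd : World → (World → Set) → Set
    Nbhd w α = Σ (NbhdCode w) λ ns → ∀ v → (α v → ⟦ ns ⟧ v) × (⟦ ns ⟧ v → α v)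

    ⟦⟧-Nbhd : ∀ {w} (ns : NbhdCode w) → Nbhd w ⟦ ns ⟧
    ⟦⟧-Nbhd ns = ns , λ v → (λ x → x) , (λ x → x)

    M : Model
    M = record
      { W = World
      ; w₀ = w₀
      ; N = Nbhd
      ; V = λ p w → SF.mem (atom p) (g (proj₁ w))
      ; N-ext = λ w α β e (ns , f) → ns , λ v → (λ bv → proj₁ (f v) (Equivalence.from (e v) bv)) , λ dv → Equivalence.to (e v) (proj₂ (f v) dv)
      ; N-ne = λ w α (ns , f) → let (z , dz) = ⟦⟧-nonempty ns in z , proj₂ (f z) dz
      }

    _⊨_ : World → Fml → Set₁
    w ⊨ A = _⊩_ M w A

    Forces⁺ Forces⁻ : Fml → Set₁
    Forces⁺ A = ∀ w → SF.mem A (g (proj₁ w)) → w ⊨ A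
    Forces⁻ A = ∀ w → SF.mem A (d (proj₁ w)) → ¬ w ⊨ A

    truth-⇒⁺ : ∀ {A B} → Forces⁻ A → Forces⁺ B → Forces⁺ (A ⇒ B)
    truth-⇒⁺ {A} {B} negA posB w m with SF.mem? B (g (proj₁ w)) | SF.mem? A (d (proj₁ w))
    ... | yes mB | _ = λ _ → posB w mB
    ... | no _ | yes mA = λ fa → ⊥-elim (negA w mA fa)
    ... | no nB | no nA = ⊥-elim (Saturated.no-impL (world-saturated (proj₂ w)) ((A ⇒ B) , m , nB , nA))

    truth-⇒⁻ : ∀ {A B} → Forces⁺ A → Forces⁻ B → Forces⁻ (A ⇒ B)
    truth-⇒⁻ {A} {B} posA negB w m f with SF.mem? A (g (proj₁ w)) | SF.mem? B (d (proj₁ w))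
    ... | yes mA | yes mB = negB w mB (f (posA w mA))
    ... | no nA | _ = Saturated.no-impR (world-saturated (proj₂ w)) ((A ⇒ B) , m , λ x → nA (proj₁ x))
    ... | yes _ | no nB = Saturated.no-impR (world-saturated (proj₂ w)) ((A ⇒ B) , m , λ x → nB (proj₂ x))

    truth-≼⁺ : ∀ {A B} → Forces⁺ A → Forces⁻ B → Forces⁺ (A ≼ B)
    truth-≼⁺ {A} {B} posA negB w m α (ns , f) (v , αv , vB) =
      let z , z∈ , zA = pick ns (proj₁ (f v) αv) in z , proj₂ (f z) z∈ , zA
      where
      tw = proj₁ w
      sat = world-saturated (proj₂ w)
      fromBlock : ∀ u → Survives K u → SameCluster tw u → ∀ σ σ' → σ SF.⊆ σ' → SB.mem (σ' , A) (b u) →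
                  Σ World λ z → InNbhd tw σ (proj₁ z) × z ⊨ A
      fromBlock u su cl σ σ' le mA with close u (world-saturated su) σ' A mA
      ... | σ'' , le' , mk'' , cl'' = let z , iz , mAz = witness-InNbhd tw u su cl σ'' A mk'' cl'' σ (SF.⊆-trans le le') in z , iz , posA z mAz
      inNbhd : ∀ σ → InNbhd tw σ (proj₁ v) → Σ World λ z → InNbhd tw σ (proj₁ z) × z ⊨ A
      inNbhd σ (u' , su' , cl' , σ' , D' , mk' , clσ' , le , mD , sd , po) with clσ' (A ≼ B) (SameClusterIf-pref (isA L) A B cl' m)
      ... | inj₁ mB = ⊥-elim (negB v (SF.mem-⊆ B sd mB) vB)
      ... | inj₂ mA' = fromBlock u' su' cl' σ σ' le mA'
      pick : (ns : NbhdCode w) → ⟦ ns ⟧ v → Σ World λ z → ⟦ ns ⟧ z × z ⊨ A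
      pick (byBlock u su cl σ C mk clσ) (inj₁ ia) = let z , iz , zA = inNbhd σ ia in z , inj₁ iz , zA
      pick (byBlock u su cl σ C mk clσ) (inj₂ (hW , refl)) with SameCluster-W L hW cl
      ... | refl with SF.mem? B σ | clσ (A ≼ B) m
      ...   | yes mB | _ = ⊥-elim (negB w (W-block⊆d sat hW σ C mk B mB) vB)
      ...   | no nB | inj₁ mB = ⊥-elim (nB mB)
      ...   | no _ | inj₂ mA' = let z , iz , zA = fromBlock u su cl σ σ (SF.⊆-refl σ) mA' in z , inj₁ iz , zA
      pick (byT hT) (inj₁ refl) with SB.mem? (single falsum , A) (b tw)
      ... | no nk = ⊥-elim (Saturated.no-T sat ((A ≼ B) , m , hT , (λ mB → negB w mB vB) , nk))
      ... | yes mk = let z , iz , zA = fromBlock tw (proj₂ w) (SameClusterIf-refl (isA L) tw) SF.empty _ (SF.empty-⊆ _) mk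
                     in z , inj₂ iz , zA
      pick (byT hT) (inj₂ ia) = let z , iz , zA = inNbhd SF.empty ia in z , inj₂ iz , zA
      pick (byC hC) refl with SF.mem? A (g tw)
      ... | yes mA = w , refl , posA w mA
      ... | no nA = ⊥-elim (Saturated.no-C sat ((A ≼ B) , m , hC , (λ mB → negB w mB vB) , nA))

    blockNbhd : ∀ w σ C → SB.mem (σ , C) (b (proj₁ w)) →
                Σ (NbhdCode w) λ ns → (Σ World λ z → ⟦ ns ⟧ z × SF.mem C (g (proj₁ z)))
                                    × (∀ u → ⟦ ns ⟧ u → ∀ a → SF.mem a σ → SF.mem a (d (proj₁ u)))
    blockNbhd w σ C mk with close (proj₁ w) (world-saturated (proj₂ w)) σ C mk
    ... | σ' , le , mk' , cl' =
      let z , iz , mCz = witness-InNbhd (proj₁ w) (proj₁ w) (proj₂ w) inCluster σ' C mk' cl' σ' (SF.⊆-refl σ')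
      in byBlock (proj₁ w) (proj₂ w) inCluster σ' C mk' cl' , (z , inj₁ iz , mCz) , σ⊆
      where
      inCluster = SameClusterIf-refl (isA L) (proj₁ w)
      σ⊆ : ∀ u → ⟦ byBlock (proj₁ w) (proj₂ w) inCluster σ' C mk' cl' ⟧ u → ∀ a → SF.mem a σ → SF.mem a (d (proj₁ u))
      σ⊆ u (inj₁ (_ , _ , _ , _ , _ , _ , _ , le₂ , _ , sd , _)) a ma = SF.mem-⊆ a sd (SF.mem-⊆ a le₂ (SF.mem-⊆ a le ma))
      σ⊆ u (inj₂ (hW , refl)) a ma = W-block⊆d (world-saturated (proj₂ w)) hW σ' C mk' a (SF.mem-⊆ a le ma)

    truth-≼⁻ : ∀ {A B} → Forces⁻ A → Forces⁺ B → Forces⁻ (A ≼ B)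
    truth-≼⁻ {A} {B} negA posB w m f with SB.mem? (single A , B) (b (proj₁ w))
    ... | no nk = Saturated.no-prefR (world-saturated (proj₂ w)) ((A ≼ B) , m , nk)
    ... | yes mk =
      let ns , (z , z∈ , mBz) , σ⊆ = blockNbhd w (single A) B mk
          u , u∈ , uA = f ⟦ ns ⟧ (⟦⟧-Nbhd ns) (z , z∈ , posB z mBz)
      in negA u (σ⊆ u u∈ A (SF.mem-insert-self A SF.empty (proj₁ (≼-closed (mem⇒∈S (d (proj₁ w)) m))))) uA

    truth : ∀ A → Forces⁺ A × Forces⁻ A
    truth (atom p) = (λ w m → lift m) , λ w m f → proj₂ (world-consistent (proj₂ w)) (atom p , lower f , (p , refl) , m)
    truth falsum = (λ w m → ⊥-elim (proj₁ (world-consistent (proj₂ w)) m)) , λ _ _ f → lower f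
    truth (A ⇒ B) = let posA , negA = truth A ; posB , negB = truth B in truth-⇒⁺ negA posB , truth-⇒⁻ posA negB
    truth (A ≼ B) = let posA , negA = truth A ; posB , negB = truth B in truth-≼⁺ posA negB , truth-≼⁻ negA posB

    condN : T (isN L) → CondN M
    condN hN w with SB.mem? (single falsum , verum) (b (proj₁ w))
    ... | no nk = ⊥-elim (Saturated.no-N (world-saturated (proj₂ w)) (hN , nk))
    ... | yes mk = let ns , _ = blockNbhd w _ verum mk in ⟦ ns ⟧ , ⟦⟧-Nbhd ns

    condT : T (isT L) → CondT M
    condT hT w = ⟦ byT hT ⟧ , ⟦⟧-Nbhd (byT hT) , inj₁ refl

    ∈⟦⟧-W : T (isW L) → ∀ {w} (ns : NbhdCode w) → ⟦ ns ⟧ w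
    ∈⟦⟧-W hW (byBlock _ _ _ _ _ _ _) = inj₂ (hW , refl)
    ∈⟦⟧-W hW (byT _) = inj₁ refl
    ∈⟦⟧-W hW (byC _) = refl

    condW : T (isW L) → T (isT L) → CondW M
    condW hW hT w = (⟦ byT hT ⟧ , ⟦⟧-Nbhd (byT hT)) , λ α (ns , f) → proj₂ (f w) (∈⟦⟧-W hW ns)

    condC : T (isC L) → T (isW L) → CondC M
    condC hC hW w = ⟦⟧-Nbhd (byC hC) , λ α (ns , f) → proj₂ (f w) (∈⟦⟧-W hW ns)

    module _ (hA : T (isA L)) (nW : ¬ T (isW L)) (nT : ¬ T (isT L)) (nC : ¬ T (isC L)) where

      cluster⇔ : ∀ {w u} → SameCluster w u ⇔ AgreeOnPrefs u w
      cluster⇔ = SameClusterIf-true (isA L) hA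

      ⟦⟧-agrees : ∀ {w v} (ns : NbhdCode w) → ⟦ ns ⟧ v → AgreeOnPrefs (proj₁ v) (proj₁ w)
      ⟦⟧-agrees {w} {v} (byBlock _ _ _ _ _ _ _) (inj₁ (u , _ , cl , _ , _ , _ , _ , _ , _ , _ , agree)) =
        AgreeOnPrefs-trans (proj₁ v) u (proj₁ w) (agree hA) (Equivalence.to cluster⇔ cl)
      ⟦⟧-agrees (byBlock _ _ _ _ _ _ _) (inj₂ (hW , _)) = ⊥-elim (nW hW)
      ⟦⟧-agrees (byT hT) _ = ⊥-elim (nT hT)
      ⟦⟧-agrees (byC hC) _ = ⊥-elim (nC hC)

      InNbhd-transport : ∀ a c σ x → AgreeOnPrefs a c → InNbhd a σ x → InNbhd c σ x
      InNbhd-transport a c σ x e (u , su , cl , r) =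
        u , su , Equivalence.from cluster⇔ (AgreeOnPrefs-trans u a c (Equivalence.to cluster⇔ cl) e) , r

      Nbhd-transport : ∀ (β : World → Set) a c → AgreeOnPrefs (proj₁ a) (proj₁ c) → Nbhd a β → Nbhd c β
      Nbhd-transport β a c e (byBlock u su cl σ C mk clσ , f) = byBlock u su cl' σ C mk clσ , λ x → to x , from x
        where
        cl' = Equivalence.from cluster⇔ (AgreeOnPrefs-trans u (proj₁ a) (proj₁ c) (Equivalence.to cluster⇔ cl) e)
        to : ∀ x → β x → ⟦ byBlock {c} u su cl' σ C mk clσ ⟧ x
        to x βx with proj₁ (f x) βx
        ... | inj₁ ia = inj₁ (InNbhd-transport (proj₁ a) (proj₁ c) σ (proj₁ x) e ia)
        ... | inj₂ (hW , _) = ⊥-elim (nW hW)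
        from : ∀ x → ⟦ byBlock {c} u su cl' σ C mk clσ ⟧ x → β x
        from x (inj₁ ia) = proj₂ (f x) (inj₁ (InNbhd-transport (proj₁ c) (proj₁ a) σ (proj₁ x) (AgreeOnPrefs-sym (proj₁ a) (proj₁ c) e) ia))
        from x (inj₂ (hW , _)) = ⊥-elim (nW hW)
      Nbhd-transport β a c e (byT hT , _) = ⊥-elim (nT hT)
      Nbhd-transport β a c e (byC hC , _) = ⊥-elim (nC hC)

      condA : CondA M
      condA w α v (ns , f) αv β = mk⇔ (Nbhd-transport β v w agree) (Nbhd-transport β w v (AgreeOnPrefs-sym (proj₁ v) (proj₁ w) agree))
        where
        agree = ⟦⟧-agrees ns (proj₁ (f v) αv)

    ⋁-refute : ∀ (xs : List Fml) (w : World) → (∀ a → a ∈ xs → ¬ w ⊨ a) → ¬ w ⊨ ⋁ xs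
    ⋁-refute [] w r f = lower f
    ⋁-refute (x ∷ xs) w r f = ⋁-refute xs w (λ a m → r a (there m)) (f (λ px → lift (r x (here refl) px)))

    block-refuted : ∀ (w : World) σ C → SB.mem (σ , C) (b (proj₁ w)) → ∀ Σl → (∀ a → a ∈ Σl → SF.mem a σ) → ¬ w ⊨ (⋁ Σl ≼ C)
    block-refuted w σ C mk Σl inc f =
      let ns , (z , z∈ , mCz) , σ⊆ = blockNbhd w σ C mk
          u , u∈ , uΣ = f ⟦ ns ⟧ (⟦⟧-Nbhd ns) (z , z∈ , proj₁ (truth C) z mCz)
      in ⋁-refute Σl u (λ a m → proj₂ (truth a) u (σ⊆ u u∈ a (inc a m))) uΣ

  module Refutation (H : Hyp) (inS : ∀ {c x} → c ∈ H → x ∈ compFormulas c → x ∈ S) where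

    blocksOf : List Item → List Block
    blocksOf [] = []
    blocksOf (fml _ ∷ Δ) = blocksOf Δ
    blocksOf (blk Σl C ∷ Δ) = (SF.fromList Σl , C) ∷ blocksOf Δ

    ∈-blocksOf⁻ : ∀ {k} Δ → k ∈ blocksOf Δ → Σ (List Fml) λ Σl → Σ Fml λ C → (k ≡ (SF.fromList Σl , C)) × (blk Σl C ∈ Δ)
    ∈-blocksOf⁻ (fml _ ∷ Δ) m with ∈-blocksOf⁻ Δ m
    ... | Σl , C , e , bi = Σl , C , e , there bi
    ∈-blocksOf⁻ (blk Σl C ∷ Δ) (here refl) = Σl , C , refl , here refl
    ∈-blocksOf⁻ (blk _ _ ∷ Δ) (there m) with ∈-blocksOf⁻ Δ m
    ... | Σl , C , e , bi = Σl , C , e , there bi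

    ∈-blocksOf⁺ : ∀ {Σl C} Δ → blk Σl C ∈ Δ → (SF.fromList Σl , C) ∈ blocksOf Δ
    ∈-blocksOf⁺ (fml _ ∷ Δ) (there m) = ∈-blocksOf⁺ Δ m
    ∈-blocksOf⁺ (blk Σl C ∷ Δ) (here refl) = here refl
    ∈-blocksOf⁺ (blk _ _ ∷ Δ) (there m) = there (∈-blocksOf⁺ Δ m)

    stateOf : Comp → State
    stateOf (Γ ⇛ Δ) = state (SF.fromList Γ) (SF.fromList (fmlsOf Δ)) (SB.fromList (blocksOf Δ))

    ≽-stateOf : ∀ c → c ≽ stateOf c
    ≽-stateOf (Γ ⇛ Δ) = (λ a m → SF.mem-fromList⁻ Γ m) , (λ a m → ∈-fmlsOf⁻ (SF.mem-fromList⁻ (fmlsOf Δ) m)) , fb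
      where
      fb : ∀ σ C → SB.mem (σ , C) (SB.fromList (blocksOf Δ)) → Σ (List Fml) λ Σl → (blk Σl C ∈ Δ) × (∀ a → SF.mem a σ → a ∈ Σl)
      fb σ C m with ∈-blocksOf⁻ Δ (SB.mem-fromList⁻ {a = σ , C} (blocksOf Δ) m)
      ... | Σl , .C , refl , bi = Σl , bi , λ a x → SF.mem-fromList⁻ Σl x

    module StateOfComponent {Γ Δ} (p : (Γ ⇛ Δ) ∈ H) where
      itemFormula∈S : ∀ {i y} → i ∈ Δ → y ∈ itemFormulas i → y ∈ S
      itemFormula∈S i∈ y∈ = inS p (∈-++⁺ʳ Γ (∈-concatMap⁺ itemFormulas {xs = Δ} (lose i∈ y∈)))

      mem-antecedent : ∀ a → a ∈ Γ → SF.mem a (g (stateOf (Γ ⇛ Δ)))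
      mem-antecedent a m = SF.mem-fromList⁺ Γ (λ y q → inS p (∈-++⁺ˡ q)) m

      mem-succedent : ∀ a → a ∈ fmlsOf Δ → SF.mem a (d (stateOf (Γ ⇛ Δ)))
      mem-succedent a m = SF.mem-fromList⁺ (fmlsOf Δ) (λ y q → itemFormula∈S (∈-fmlsOf⁻ q) (here refl)) m

      mem-blocks : ∀ Σl C → blk Σl C ∈ Δ → SB.mem (SF.fromList Σl , C) (b (stateOf (Γ ⇛ Δ)))
      mem-blocks Σl C bi = SB.mem-fromList⁺ (blocksOf Δ) inUniverse (∈-blocksOf⁺ Δ bi)
        where
        inUniverse : ∀ y → y ∈ blocksOf Δ → y ∈ blockUniverse
        inUniverse y q with ∈-blocksOf⁻ Δ q
        ... | Σl' , C' , refl , bi' = ∈-blockUniverse (SF.fromList Σl') (itemFormula∈S bi' (here refl))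

      mem-block-formulas : ∀ Σl C → blk Σl C ∈ Δ → ∀ a → a ∈ Σl → SF.mem a (SF.fromList Σl)
      mem-block-formulas Σl C bi a m = SF.mem-fromList⁺ Σl (λ y q → itemFormula∈S bi (there q)) m

    module WithStableLevel (K : ℕ) (stable : ∀ u → Survives K u → Survives (suc K) u) where

      derivableOrAllSurvive : ∀ (H' : Hyp) → (Σ Comp λ c → (c ∈ H') × Derivable (stateOf c)) ⊎ (∀ c → c ∈ H' → Survivor K (stateOf c))
      derivableOrAllSurvive [] = inj₂ λ c ()
      derivableOrAllSurvive (c ∷ H') with derivableOrSurvivor K (stateOf c) | derivableOrAllSurvive H'
      ... | inj₁ der | _ = inj₁ (c , here refl , der)
      ... | inj₂ _ | inj₁ (c' , m , der) = inj₁ (c' , there m , der)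
      ... | inj₂ sur | inj₂ surs = inj₂ λ where
        c' (here refl) → sur
        c' (there m) → surs c' m

      someSurvivor : ∀ H' → (∀ c → c ∈ H' → Survivor K (stateOf c)) → H' ≢ [] → Σ State (Survives K)
      someSurvivor [] _ ne = ⊥-elim (ne refl)
      someSurvivor (c ∷ _) surs _ = let u , xu , _ = surs c (here refl) in u , xu

      module _ (w₀ : Σ State (Survives K)) where
        open Countermodel K stable w₀

        ⋀-intro : ∀ (Γ : List Fml) (w : World) → (∀ a → a ∈ Γ → w ⊨ a) → w ⊨ ⋀ Γ
        ⋀-intro [] w h = λ x → x
        ⋀-intro (a ∷ Γ) w h = λ f → f (h a (here refl)) (⋀-intro Γ w (λ x m → h x (there m)))

        refute : ∀ {Γ Δ} → (Γ ⇛ Δ) ∈ H → ∀ (w : World) → stateOf (Γ ⇛ Δ) ⊑ proj₁ w → ¬ w ⊨ interp (Γ ⇛ Δ)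
        refute {Γ} {Δ} p w (lg , ld , lb) f =
          ⋁-refute (blksOf Δ) w refuteBlock (f antecedent (λ px → lift (⋁-refute (fmlsOf Δ) w refuteFml px)))
          where
          open StateOfComponent p
          antecedent : w ⊨ ⋀ Γ
          antecedent = ⋀-intro Γ w (λ a m → proj₁ (truth a) w (SF.mem-⊆ a lg (mem-antecedent a m)))
          refuteFml : ∀ a → a ∈ fmlsOf Δ → ¬ w ⊨ a
          refuteFml a m = proj₂ (truth a) w (SF.mem-⊆ a ld (mem-succedent a m))
          refuteBlock : ∀ x → x ∈ blksOf Δ → ¬ w ⊨ x
          refuteBlock x m with ∈-blksOf⁻ {Δ = Δ} m
          ... | Σl , C , refl , bi =
            block-refuted w (SF.fromList Σl) C (SB.mem-⊆ _ lb (mem-blocks Σl C bi)) Σl (mem-block-formulas Σl C bi)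

      complete : (∀ w₀ → IsModel L (Countermodel.M K stable w₀)) → ¬ ValidL L [] → ValidL L H → ⊢[ L ] H
      complete isModel ¬valid[] valid with derivableOrAllSurvive H
      ... | inj₁ (c , m , der) = let H' , pr = ∈⇒∷↭ m in ex-H pr (der H' c (≽-stateOf c))
      ... | inj₂ surs =
        let w₀ = someSurvivor H surs (λ e → ¬valid[] (subst (ValidL L) e valid))
            c , m , valid-c = find (valid (Countermodel.M K stable w₀) (isModel w₀))
            u , xu , le = surs c m
        in ⊥-elim (refute w₀ m (u , xu) le (valid-c _))

trivialModel : Model
trivialModel = record
  { W = ⊤
  ; w₀ = tt
  ; N = λ w α → α tt
  ; V = λ _ _ → ⊥
  ; N-ext = λ w α β e a → Equivalence.to (e tt) a
  ; N-ne = λ w α a → tt , a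
  }

trivialModel-isModel : ∀ L → IsModel L trivialModel
trivialModel-isModel LN = lift tt
trivialModel-isModel LNN = λ w → (λ _ → ⊤) , tt
trivialModel-isModel LNT = λ w → (λ _ → ⊤) , tt , tt
trivialModel-isModel LNW = λ w → ((λ _ → ⊤) , tt) , λ α a → a
trivialModel-isModel LNC = λ { tt → refl , λ α a → a }
trivialModel-isModel LNA = λ w α v _ _ β → mk⇔ (λ x → x) (λ x → x)
trivialModel-isModel LNNA = (λ w → (λ _ → ⊤) , tt) , λ w α v _ _ β → mk⇔ (λ x → x) (λ x → x)

¬valid-[] : ∀ L → ¬ ValidL L []
¬valid-[] L valid with valid trivialModel (trivialModel-isModel L)
... | ()

countermodel-isModel : ∀ L {S} (closed : SubformulaClosed S) K stable w₀ → IsModel L (Completeness.Countermodel.M L closed K stable w₀)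
countermodel-isModel LN closed K stable w₀ = lift tt
countermodel-isModel LNN closed K stable w₀ = condN tt where open Completeness.Countermodel LNN closed K stable w₀
countermodel-isModel LNT closed K stable w₀ = condT tt where open Completeness.Countermodel LNT closed K stable w₀
countermodel-isModel LNW closed K stable w₀ = condW tt tt where open Completeness.Countermodel LNW closed K stable w₀
countermodel-isModel LNC closed K stable w₀ = condC tt tt where open Completeness.Countermodel LNC closed K stable w₀
countermodel-isModel LNA closed K stable w₀ = condA tt (λ ()) (λ ()) (λ ()) where open Completeness.Countermodel LNA closed K stable w₀
countermodel-isModel LNNA closed K stable w₀ = condN tt , condA tt (λ ()) (λ ()) (λ ())
  where open Completeness.Countermodel LNNA closed K stable w₀

theorem5p8 : (L : Logic) (H : Hyp) → ValidL L H → ⊢[ L ] H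
theorem5p8 L H valid =
  let K , stable = Completeness.stabilises L closed
  in Completeness.Refutation.WithStableLevel.complete L closed H inS K stable
       (countermodel-isModel L closed K stable) (¬valid-[] L) valid
  where
  universe : List Fml
  universe = verum ∷ concatMap compFormulas H
  closed : SubformulaClosed (concatMap subformulas universe)
  closed = concatMap-subformulas-closed universe (here refl)
  inS : ∀ {c x} → c ∈ H → x ∈ compFormulas c → x ∈ concatMap subformulas universe
  inS p m = ∈-concatMap-subformulas-self universe (there (∈-concatMap⁺ compFormulas (lose p m)))
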